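{- For every integer $n>2$, let $C_n(123,231)$ denote the number of cyclic permutations of length $n$ that avoid both patterns $123$ and $231$. Then \[ C_n(123,231)=\begin{cases} \phi(2k)=\phi(n/2) & \text{if } n=4k,\\[2pt] \phi(k+1)+\phi(2k+1)=\phi\!\left(\frac{n+2}{4}\right)+\phi\!\left(\frac{n}{2}\right) & \text{if } n=4k+2,\\[2pt] \phi(m)=\phi\!\left(\frac{n+1}{2}\right) & \text{if } n=2m-1, \end{cases} \] where $k$ and $m$ denote positive integers and $\phi$ is Euler's totient function.
   Context: A permutation of length $n$ is a linear order $p=p_1p_2\cdots p_n$ of $[n]=\{1,\dots,n\}$, also viewed as the bijection $i\mapsto p_i$. It is cyclic if, as a bijection of $[n]$, it consists of a single cycle of length $n$. A permutation $p$ contains a pattern $q=q_1\cdots q_k$ if there are indices $i_1<\cdots<i_k$ such that for all $j,r$, $q_j<q_r$ iff $p_{i_j}<p_{i_r}$; otherwise $p$ avoids $q$. For a positive integer $z$, $\phi(z)$ is the number of integers in $\{1,\dots,z\}$ relatively prime to $z$. -}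

module Defs where

open import Data.Nat using (ℕ; zero; suc; _<_)
open import Data.Nat.GCD using (gcd)
open import Data.Nat.Properties using (_≟_)
open import Data.Fin using (Fin) renaming (zero to fzero; suc to fsuc)
open import Data.Fin using () renaming (_<_ to _<ᶠ_)
open import Data.Vec using (Vec; lookup; _∷_; [])
open import Data.List using (List; length; filter; map; upTo)
open import Data.List.Membership.Propositional using (_∈_)
open import Data.List.Relation.Unary.Unique.Propositional using (Unique)
open import Data.Product using (Σ; ∃; _×_)
open import Function.Bundles using (_⇔_)
open import Function.Definitions using (Injective)
open import Relation.Binary.PropositionalEquality using (_≡_)
open import Relation.Nullary using (¬_)

φ : ℕ → ℕ
φ z = length (filter (λ i → gcd i z ≟ 1) (map suc (upTo z)))

-- A permutation of length n, as the word p₁…pₙ (values in Fin n, 0-based),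
-- i.e. a vector whose lookup map i ↦ pᵢ is injective (hence bijective).
IsPerm : (n : ℕ) → Vec (Fin n) n → Set
IsPerm n p = Injective _≡_ _≡_ (lookup p)

iter : {n : ℕ} → Vec (Fin n) n → ℕ → Fin n → Fin n
iter p zero i = i
iter p (suc k) i = lookup p (iter p k i)

-- cyclic: a single cycle of length n, i.e. the orbit of every element is all of [n]
IsCyclic : (n : ℕ) → Vec (Fin n) n → Set
IsCyclic n p = (i j : Fin n) → ∃ λ k → iter p k i ≡ j

Contains : {n k : ℕ} → Vec (Fin n) n → Vec (Fin k) k → Set
Contains {n} {k} p q =
  Σ (Fin k → Fin n) λ f →
    ((a b : Fin k) → a <ᶠ b → f a <ᶠ f b) ×
    ((a b : Fin k) → (lookup q a <ᶠ lookup q b) ⇔ (lookup p (f a) <ᶠ lookup p (f b)))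

Avoids : {n k : ℕ} → Vec (Fin n) n → Vec (Fin k) k → Set
Avoids p q = ¬ Contains p q

pat123 : Vec (Fin 3) 3
pat123 = fzero ∷ fsuc fzero ∷ fsuc (fsuc fzero) ∷ []

pat231 : Vec (Fin 3) 3
pat231 = fsuc fzero ∷ fsuc (fsuc fzero) ∷ fzero ∷ []

CycAvoid : (n : ℕ) → Vec (Fin n) n → Set
CycAvoid n p = IsPerm n p × IsCyclic n p × Avoids p pat123 × Avoids p pat231

-- "the number of x satisfying P is c": some duplicate-free list enumerates
-- exactly the x with P x, and it has length c
HasCount : {A : Set} → (A → Set) → ℕ → Set
HasCount {A} P c = Σ (List A) λ L → Unique L × ((x : A) → (x ∈ L) ⇔ P x) × length L ≡ c

CountIs : ℕ → ℕ → Set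
CountIs n c = HasCount (CycAvoid n) c

module Submission where

-- A permutation avoids 123 and 231 iff it is layered: three
--    decreasing runs carrying, from left to right, the top a values, the
--    bottom b values and the remaining middle values (`layered`,
--    `LayeredPerm`, `avoider-is-layered`).
-- 2. Cycles.  If n < 2a the layered permutation σ has a cycle of length at
--    most two.  Otherwise write n = 2a + d and M = a + d.  The first-return
--    map of σ to the positions [a, n) is U = K ∘ T for two involutions of
--    [0, M), so K reverses the cycle of U; off the fixed interval [0, d) of K,
--    U is the rotation by M - b.  Hence σ is cyclic iff either d ≤ 1 and
--    gcd(b, M) = 1, or d = 2, a = 2k, b = 2i and gcd(i, k + 1) = 1; for d ≥ 3
--    or the other parities K has too many fixed points (`CyclicLayered`,
--    `cyclic⇒parameters`, `parameters⇒cyclic`).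
-- 3. Counting.  Parametrising the cyclic avoiders by b, resp. i, gives φ(2k)
--    for n = 4k, φ(m) for n = 2m - 1, and φ(k + 1) + φ(2k + 1) for n = 4k + 2
--    (`count-rotations`, `count-4k+2`).

open import Defs
open import Data.Nat
open import Data.Nat.Properties
open import Data.Nat.DivMod
open import Data.Nat.Divisibility using (_∣_; divides; ∣⇒≤; ∣m+n∣m⇒∣n; %-presˡ-∣; ∣1⇒≡1; n∣m⇒m%n≡0; m%n≡0⇒n∣m; 0∣⇒≡0; ∣m∣n⇒∣m+n; _∣0; ∣-refl)
open import Data.Nat.GCD using (gcd; gcd-greatest; gcd-identityˡ; module Bézout; gcd[m,n]∣m; gcd[m,n]∣n)
import Data.Nat.Coprimality as Cop
open import Data.Nat.Tactic.RingSolver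
open import Data.Product using (Σ; _×_; _,_; proj₁; proj₂)
open import Data.Sum using (_⊎_; inj₁; inj₂)
open import Data.Sum.Properties using (inj₁-injective; inj₂-injective)
open import Data.Empty
open import Relation.Nullary
open import Relation.Binary.PropositionalEquality
open import Relation.Binary.Definitions using (tri<; tri≈; tri>)
open import Function using (_∘_)
open import Function.Bundles using (Equivalence; mk⇔)
open import Data.Fin using (Fin; toℕ; fromℕ<) renaming (zero to fz; suc to fs; _<_ to _<ᶠ_)
import Data.Fin.Properties as FinP
open import Data.Vec using (Vec; lookup; tabulate; []; _∷_)
import Data.Vec.Properties as VecP
open import Data.List using (List; []; _∷_; length; filter; map; upTo; _++_)
open import Data.List.Properties using (length-map; length-++)
open import Data.List.Membership.Propositional using (_∈_)
open import Data.List.Membership.Propositional.Properties using (∈-map⁺; ∈-map⁻; ∈-filter⁺; ∈-filter⁻; ∈-upTo⁺; ∈-upTo⁻; ∈-++⁺ˡ; ∈-++⁺ʳ; ∈-++⁻)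
open import Data.List.Relation.Unary.Any using (here; there)
open import Data.List.Relation.Unary.All using (All; []; _∷_)
open import Data.List.Relation.Unary.AllPairs using ([]; _∷_)
open import Data.List.Relation.Unary.Unique.Propositional using (Unique)
import Data.List.Relation.Unary.Unique.Propositional.Properties as UP

balance-< : ∀ {x y s t : ℕ} → x + s ≡ y + t → s < t → y < x
balance-< {x} {y} {s} {t} eq s<t with y <? x
... | yes y<x = y<x
... | no y≮x = ⊥-elim (<-irrefl eq (+-mono-≤-< (≮⇒≥ y≮x) s<t))

balance-≤ : ∀ {x y s t : ℕ} → x + s ≡ y + t → s ≤ t → y ≤ x
balance-≤ {x} {y} {s} {t} eq s≤t with y ≤? x
... | yes y≤x = y≤x
... | no y≰x = ⊥-elim (<-irrefl eq (+-mono-<-≤ (≰⇒> y≰x) s≤t))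

swap-suc : ∀ x y → x + suc y ≡ y + suc x
swap-suc x y = trans (+-suc x y) (trans (cong suc (+-comm x y)) (sym (+-suc y x)))

+-suc-cancelʳ-< : ∀ {x y} c → x + suc c ≤ y + c → x < y
+-suc-cancelʳ-< {x} {y} c h = +-cancelʳ-< c x y (subst (_≤ y + c) (+-suc x c) h)

m<n⇒∃[o]m+suc[o]≡n : ∀ {i j} → i < j → Σ ℕ λ o → i + suc o ≡ j
m<n⇒∃[o]m+suc[o]≡n {i} (s≤s i≤j') with m≤n⇒∃[o]m+o≡n i≤j'
... | o , eq = o , trans (+-suc i o) (cong suc eq)

double-injective : ∀ {k h} → k + k ≡ h + h → k ≡ h
double-injective {zero} {zero} e = refl
double-injective {suc k} {suc h} e =
  cong suc (double-injective (suc-injective (trans (sym (+-suc k k)) (trans (suc-injective e) (+-suc h h)))))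

odd≢even : ∀ k h → suc (k + k) ≢ h + h
odd≢even zero (suc h) e = 0≢1+n (trans (suc-injective e) (+-suc h h))
odd≢even (suc k) (suc h) e =
  odd≢even k h (suc-injective (trans (sym (+-suc (suc k) k)) (trans (suc-injective e) (+-suc h h))))

double-cancel-≤ : ∀ {x y} → x + x ≤ y + y → x ≤ y
double-cancel-≤ {x} {y} h with x ≤? y
... | yes x≤y = x≤y
... | no x≰y = ⊥-elim (<⇒≱ (+-mono-< (≰⇒> x≰y) (≰⇒> x≰y)) h)

≢0∧≢1⇒≥2 : ∀ {x} → x ≢ 0 → x ≢ 1 → 2 ≤ x
≢0∧≢1⇒≥2 {zero} h0 h1 = ⊥-elim (h0 refl)
≢0∧≢1⇒≥2 {suc zero} h0 h1 = ⊥-elim (h1 refl)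
≢0∧≢1⇒≥2 {suc (suc x)} h0 h1 = s≤s (s≤s z≤n)

-- For a + b ≤ n, `layered n a b` is the word on
-- positions 0 … n-1 made of three decreasing runs:
--   run₁ : positions [0, a)     carry the values n-1, …, n-a,
--   run₂ : positions [a, a+b)   carry the values b-1, …, 0,
--   run₃ : positions [a+b, n)   carry the values n-a-1, …, b.
-- Inside a run, value + (position + 1) is constant: n, a + b and n + b.
layered : ℕ → ℕ → ℕ → ℕ → ℕ
layered n a b i with i <? a
... | yes _ = n ∸ suc i
... | no _ with i <? a + b
...   | yes _ = a + b ∸ suc i
...   | no _ = n + b ∸ suc i

data Run (a b i : ℕ) : Set where
  in₁ : i < a → Run a b i
  in₂ : a ≤ i → i < a + b → Run a b i
  in₃ : a + b ≤ i → Run a b i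

run : ∀ a b i → Run a b i
run a b i with i <? a
... | yes i<a = in₁ i<a
... | no i≮a with i <? a + b
...   | yes i<ab = in₂ (≮⇒≥ i≮a) i<ab
...   | no i≮ab = in₃ (≮⇒≥ i≮ab)

module Runs {n a b : ℕ} (ab≤n : a + b ≤ n) where
  private
    L = layered n a b

  run₁-sum : ∀ {i} → i < a → L i + suc i ≡ n
  run₁-sum {i} i<a with i <? a
  ... | yes _ = m∸n+n≡m (≤-trans i<a (≤-trans (m≤m+n a b) ab≤n))
  ... | no i≮a = ⊥-elim (i≮a i<a)

  run₂-sum : ∀ {i} → a ≤ i → i < a + b → L i + suc i ≡ a + b
  run₂-sum {i} a≤i i<ab with i <? a
  ... | yes i<a = ⊥-elim (<⇒≱ i<a a≤i)
  ... | no _ with i <? a + b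
  ...   | yes _ = m∸n+n≡m i<ab
  ...   | no i≮ab = ⊥-elim (i≮ab i<ab)

  run₃-sum : ∀ {i} → a + b ≤ i → i < n → L i + suc i ≡ n + b
  run₃-sum {i} ab≤i i<n with i <? a
  ... | yes i<a = ⊥-elim (<⇒≱ i<a (≤-trans (m≤m+n a b) ab≤i))
  ... | no _ with i <? a + b
  ...   | yes i<ab = ⊥-elim (<⇒≱ i<ab ab≤i)
  ...   | no _ = m∸n+n≡m (≤-trans i<n (m≤m+n n b))

  run₁-high : ∀ {i} → i < a → n ≤ L i + a
  run₁-high {i} i<a = subst (_≤ L i + a) (run₁-sum i<a) (+-monoʳ-≤ (L i) i<a)

  run₂-low : ∀ {i} → a ≤ i → i < a + b → L i < b
  run₂-low {i} a≤i i<ab = +-suc-cancelʳ-< a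
    (subst (L i + suc a ≤_) (trans (run₂-sum a≤i i<ab) (+-comm a b)) (+-monoʳ-≤ (L i) (s≤s a≤i)))

  run₃-≥b : ∀ {i} → a + b ≤ i → i < n → b ≤ L i
  run₃-≥b {i} ab≤i i<n = balance-≤ {L i} {b} {suc i} {n} (trans (run₃-sum ab≤i i<n) (+-comm n b)) i<n

  run₃-below : ∀ {i} → a + b ≤ i → i < n → L i + a < n
  run₃-below {i} ab≤i i<n = +-cancelʳ-< b _ _
    (subst₂ _<_ (sym (+-assoc (L i) a b)) (run₃-sum ab≤i i<n) (+-monoʳ-< (L i) (s≤s ab≤i)))

  layered-< : ∀ {i} → i < n → L i < n
  layered-< {i} i<n with run a b i
  ... | in₁ h = subst (L i <_) (run₁-sum h) (m<m+n _ z<s)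
  ... | in₂ h1 h2 = ≤-trans (run₂-low h1 h2) (≤-trans (m≤n+m b a) ab≤n)
  ... | in₃ h = ≤-trans (s≤s (m≤m+n _ a)) (run₃-below h i<n)

  descent-in-run : ∀ {x y c} → x < y → L x + suc x ≡ c → L y + suc y ≡ c → L y < L x
  descent-in-run x<y ex ey = balance-< (trans ex (sym ey)) (s≤s x<y)

  run₁-above-rest : ∀ {x y} → x < a → a ≤ y → y < n → L y < L x
  run₁-above-rest {x} {y} x<a a≤y y<n with run a b y
  ... | in₁ h = ⊥-elim (<⇒≱ h a≤y)
  ... | in₂ h1 h2 = +-cancelʳ-< a _ _
        (≤-trans (+-monoˡ-< a (run₂-low h1 h2)) (≤-trans (≤-reflexive (+-comm b a)) (≤-trans ab≤n (run₁-high x<a))))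
  ... | in₃ h = +-cancelʳ-< a _ _ (≤-trans (run₃-below h y<n) (run₁-high x<a))

  data Comparison (x y : ℕ) : Set where
    descent : L y < L x → Comparison x y
    ascent : a ≤ x → x < a + b → a + b ≤ y → L x < L y → Comparison x y

  compare-values : ∀ {x y} → x < y → y < n → Comparison x y
  compare-values {x} {y} x<y y<n with run a b x | run a b y
  ... | in₁ hx | in₁ hy = descent (descent-in-run x<y (run₁-sum (<-trans x<y hy)) (run₁-sum hy))
  ... | in₁ hx | in₂ k1 k2 = descent (run₁-above-rest hx k1 y<n)
  ... | in₁ hx | in₃ k = descent (run₁-above-rest hx (≤-trans (m≤m+n a b) k) y<n)
  ... | in₂ h1 h2 | in₁ hy = ⊥-elim (<⇒≱ (<-trans x<y hy) h1)
  ... | in₂ h1 h2 | in₂ k1 k2 =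
        descent (descent-in-run x<y (run₂-sum h1 (<-trans x<y k2)) (run₂-sum (≤-trans h1 (<⇒≤ x<y)) k2))
  ... | in₂ h1 h2 | in₃ k = ascent h1 h2 k (<-≤-trans (run₂-low h1 h2) (run₃-≥b k y<n))
  ... | in₃ h | in₁ hy = ⊥-elim (<⇒≱ (<-trans x<y hy) (≤-trans (m≤m+n a b) h))
  ... | in₃ h | in₂ k1 k2 = ⊥-elim (<⇒≱ (<-trans x<y k2) h)
  ... | in₃ h | in₃ k =
        descent (descent-in-run x<y (run₃-sum h (<-trans x<y y<n)) (run₃-sum (≤-trans h (<⇒≤ x<y)) y<n))

  ascent-from-run₂-to-run₃ : ∀ {x y} → x < y → y < n → L x < L y → a ≤ x × x < a + b × a + b ≤ y
  ascent-from-run₂-to-run₃ x<y y<n lt with compare-values x<y y<n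
  ... | descent gt = ⊥-elim (<-asym lt gt)
  ... | ascent h1 h2 h3 _ = h1 , h2 , h3

  comparison-≢ : ∀ {x y} → Comparison x y → L x ≢ L y
  comparison-≢ (descent lt) e = <-irrefl (sym e) lt
  comparison-≢ (ascent _ _ _ lt) e = <-irrefl e lt

  layered-injective : ∀ {x y} → x < n → y < n → L x ≡ L y → x ≡ y
  layered-injective {x} {y} x<n y<n eq with <-cmp x y
  ... | tri≈ _ x≡y _ = x≡y
  ... | tri< x<y _ _ = ⊥-elim (comparison-≢ (compare-values x<y y<n) eq)
  ... | tri> _ _ y<x = ⊥-elim (comparison-≢ (compare-values y<x x<n) (sym eq))
-- Pattern occurrences of length three.  We read words through `valueAt`, the
-- value at a natural-number position, so that positions can be handled with
-- ordinary arithmetic.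
valueAt : ∀ {n m} → Vec (Fin n) m → ℕ → ℕ
valueAt [] _ = 0
valueAt (v ∷ vs) zero = toℕ v
valueAt (v ∷ vs) (suc i) = valueAt vs i

valueAt-lookup : ∀ {n m} (p : Vec (Fin n) m) (i : Fin m) → valueAt p (toℕ i) ≡ toℕ (lookup p i)
valueAt-lookup (v ∷ vs) fz = refl
valueAt-lookup (v ∷ vs) (fs i) = valueAt-lookup vs i

choose3 : ℕ → ℕ → ℕ → Fin 3 → ℕ
choose3 i j k fz = i
choose3 i j k (fs fz) = j
choose3 i j k (fs (fs fz)) = k

module Occurrences {n : ℕ} (p : Vec (Fin n) n) where
  private
    val = valueAt p

  module Read {q : Vec (Fin 3) 3} (occ : Contains p q) where
    pos : Fin 3 → ℕ
    pos s = toℕ (proj₁ occ s)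

    pos-< : ∀ s t → s <ᶠ t → pos s < pos t
    pos-< = proj₁ (proj₂ occ)

    pos-bound : ∀ s → pos s < n
    pos-bound s = FinP.toℕ<n (proj₁ occ s)

    value-order : ∀ s t → lookup q s <ᶠ lookup q t → val (pos s) < val (pos t)
    value-order s t lt =
      subst₂ _<_ (sym (valueAt-lookup p _)) (sym (valueAt-lookup p _)) (Equivalence.to (proj₂ (proj₂ occ) s t) lt)

  build : ∀ {i j k} (q : Vec (Fin 3) 3) → (∀ s t → lookup q s ≡ lookup q t → s ≡ t) →
          i < j → j < k → k < n →
          (∀ s t → lookup q s <ᶠ lookup q t → val (choose3 i j k s) < val (choose3 i j k t)) →
          Contains p q
  build {i} {j} {k} q q-inj i<j j<k k<n forward = position , increasing , λ s t → mk⇔ (to s t) (from s t)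
    where
    bound : ∀ s → choose3 i j k s < n
    bound fz = <-trans i<j (<-trans j<k k<n)
    bound (fs fz) = <-trans j<k k<n
    bound (fs (fs fz)) = k<n

    position : Fin 3 → Fin n
    position s = fromℕ< (bound s)

    toℕ-position : ∀ s → toℕ (position s) ≡ choose3 i j k s
    toℕ-position s = FinP.toℕ-fromℕ< (bound s)

    increasing : ∀ s t → s <ᶠ t → position s <ᶠ position t
    increasing s t s<t = subst₂ _<_ (sym (toℕ-position s)) (sym (toℕ-position t)) (chosen s t s<t)
      where
      chosen : ∀ s t → s <ᶠ t → choose3 i j k s < choose3 i j k t
      chosen fz (fs fz) _ = i<j
      chosen fz (fs (fs fz)) _ = <-trans i<j j<k
      chosen (fs fz) (fs (fs fz)) _ = j<k
      chosen (fs fz) (fs fz) (s≤s ())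
      chosen (fs (fs fz)) (fs (fs fz)) (s≤s (s≤s ()))

    value : Fin 3 → ℕ
    value s = toℕ (lookup p (position s))

    value≡ : ∀ s → value s ≡ val (choose3 i j k s)
    value≡ s = trans (sym (valueAt-lookup p (position s))) (cong val (toℕ-position s))

    to : ∀ s t → lookup q s <ᶠ lookup q t → value s < value t
    to s t lt = subst₂ _<_ (sym (value≡ s)) (sym (value≡ t)) (forward s t lt)

    -- the backward implication follows since both orders are strict and total
    from : ∀ s t → value s < value t → lookup q s <ᶠ lookup q t
    from s t lt with <-cmp (toℕ (lookup q s)) (toℕ (lookup q t))
    ... | tri< qs<qt _ _ = qs<qt
    ... | tri≈ _ qs≡qt _ = ⊥-elim (<-irrefl (cong value (q-inj s t (FinP.toℕ-injective qs≡qt))) lt)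
    ... | tri> _ _ qt<qs = ⊥-elim (<-asym lt (to t s qt<qs))

pat123-injective : ∀ s t → lookup pat123 s ≡ lookup pat123 t → s ≡ t
pat123-injective fz fz _ = refl
pat123-injective fz (fs fz) ()
pat123-injective fz (fs (fs fz)) ()
pat123-injective (fs fz) fz ()
pat123-injective (fs fz) (fs fz) _ = refl
pat123-injective (fs fz) (fs (fs fz)) ()
pat123-injective (fs (fs fz)) fz ()
pat123-injective (fs (fs fz)) (fs fz) ()
pat123-injective (fs (fs fz)) (fs (fs fz)) _ = refl

pat231-injective : ∀ s t → lookup pat231 s ≡ lookup pat231 t → s ≡ t
pat231-injective fz fz _ = refl
pat231-injective fz (fs fz) ()
pat231-injective fz (fs (fs fz)) ()
pat231-injective (fs fz) fz ()
pat231-injective (fs fz) (fs fz) _ = refl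
pat231-injective (fs fz) (fs (fs fz)) ()
pat231-injective (fs (fs fz)) fz ()
pat231-injective (fs (fs fz)) (fs fz) ()
pat231-injective (fs (fs fz)) (fs (fs fz)) _ = refl
-- The layered permutation as a word of Fin n.  Values are clamped into Fin n;
-- for the parameters we use (a + b ≤ n) the clamp never fires.
clamp : ∀ {n} → Fin n → ℕ → Fin n
clamp {n} default x with x <? n
... | yes x<n = fromℕ< x<n
... | no _ = default

toℕ-clamp : ∀ {n} (default : Fin n) x → x < n → toℕ (clamp default x) ≡ x
toℕ-clamp {n} default x x<n with x <? n
... | yes h = FinP.toℕ-fromℕ< h
... | no x≮n = ⊥-elim (x≮n x<n)

layeredPerm : (n a b : ℕ) → Vec (Fin n) n
layeredPerm n a b = tabulate (λ i → clamp i (layered n a b (toℕ i)))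

module LayeredPerm {n a b : ℕ} (ab≤n : a + b ≤ n) where
  open Runs {n} {a} {b} ab≤n

  lookup-layeredPerm : ∀ (i : Fin n) → toℕ (lookup (layeredPerm n a b) i) ≡ layered n a b (toℕ i)
  lookup-layeredPerm i =
    trans (cong toℕ (VecP.lookup∘tabulate (λ i → clamp i (layered n a b (toℕ i))) i))
          (toℕ-clamp i _ (layered-< (FinP.toℕ<n i)))

  valueAt-layeredPerm : ∀ {i} → i < n → valueAt (layeredPerm n a b) i ≡ layered n a b i
  valueAt-layeredPerm {i} i<n =
    trans (cong (valueAt (layeredPerm n a b)) (sym (FinP.toℕ-fromℕ< i<n)))
      (trans (valueAt-lookup (layeredPerm n a b) (fromℕ< i<n)) (trans (lookup-layeredPerm (fromℕ< i<n)) (cong (layered n a b) (FinP.toℕ-fromℕ< i<n))))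

  layeredPerm-isPerm : IsPerm n (layeredPerm n a b)
  layeredPerm-isPerm {i} {j} eq = FinP.toℕ-injective
    (layered-injective (FinP.toℕ<n i) (FinP.toℕ<n j)
      (trans (sym (lookup-layeredPerm i)) (trans (cong toℕ eq) (lookup-layeredPerm j))))

  -- Both patterns need an ascent followed by a later position that is compared
  -- with it in an impossible way, since ascents only go from run₂ to run₃.
  module _ {q : Vec (Fin 3) 3} (occ : Contains (layeredPerm n a b) q) where
    open Occurrences.Read (layeredPerm n a b) {q} occ

    value-order′ : ∀ s t → lookup q s <ᶠ lookup q t → layered n a b (pos s) < layered n a b (pos t)
    value-order′ s t lt =
      subst₂ _<_ (valueAt-layeredPerm (pos-bound s)) (valueAt-layeredPerm (pos-bound t)) (value-order s t lt)

    ascent₀₁ : lookup q fz <ᶠ lookup q (fs fz) → a ≤ pos fz × pos fz < a + b × a + b ≤ pos (fs fz)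
    ascent₀₁ lt = ascent-from-run₂-to-run₃ (pos-< fz (fs fz) (s≤s z≤n)) (pos-bound (fs fz)) (value-order′ fz (fs fz) lt)

  layeredPerm-avoids-123 : Avoids (layeredPerm n a b) pat123
  layeredPerm-avoids-123 occ = <-irrefl refl (<-≤-trans second-in-run₂ second-in-run₃)
    where
    open Occurrences.Read (layeredPerm n a b) {pat123} occ
    second-in-run₃ : a + b ≤ pos (fs fz)
    second-in-run₃ = proj₂ (proj₂ (ascent₀₁ {pat123} occ (s≤s z≤n)))
    second-in-run₂ : pos (fs fz) < a + b
    second-in-run₂ = proj₁ (proj₂ (ascent-from-run₂-to-run₃ (pos-< (fs fz) (fs (fs fz)) (s≤s (s≤s z≤n)))
                       (pos-bound (fs (fs fz))) (value-order′ {pat123} occ (fs fz) (fs (fs fz)) (s≤s (s≤s z≤n)))))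

  layeredPerm-avoids-231 : Avoids (layeredPerm n a b) pat231
  layeredPerm-avoids-231 occ =
    <-irrefl refl (<-≤-trans (<-trans (value-order′ {pat231} occ (fs (fs fz)) fz (s≤s z≤n)) first-low) third-high)
    where
    open Occurrences.Read (layeredPerm n a b) {pat231} occ
    first-ascent = ascent₀₁ {pat231} occ (s≤s (s≤s z≤n))
    first-low : layered n a b (pos fz) < b
    first-low = run₂-low (proj₁ first-ascent) (proj₁ (proj₂ first-ascent))
    third-high : b ≤ layered n a b (pos (fs (fs fz)))
    third-high = run₃-≥b (≤-trans (proj₂ (proj₂ first-ascent)) (<⇒≤ (pos-< (fs fz) (fs (fs fz)) (s≤s (s≤s z≤n)))))
                   (pos-bound (fs (fs fz)))

descending-drop : (f : ℕ → ℕ) (s t : ℕ) → (∀ i → s ≤ i → suc i < t → f (suc i) < f i) →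
                  ∀ i e → s ≤ i → i + e < t → f (i + e) + e ≤ f i
descending-drop f s t desc i zero s≤i _ = ≤-reflexive (trans (+-identityʳ _) (cong f (+-identityʳ i)))
descending-drop f s t desc i (suc e) s≤i i+1+e<t =
  subst (λ z → f z + suc e ≤ f i) (sym (+-suc i e))
    (≤-trans (≤-reflexive (+-suc (f (suc (i + e))) e)) (≤-trans (+-monoˡ-≤ e step) previous))
  where
  previous : f (i + e) + e ≤ f i
  previous = descending-drop f s t desc i e s≤i (<-trans (+-monoʳ-< i (n<1+n e)) i+1+e<t)
  step : f (suc (i + e)) < f (i + e)
  step = desc (i + e) (≤-trans s≤i (m≤m+n i e)) (subst (_< t) (+-suc i e) i+1+e<t)

pinned-decreasing : (f : ℕ → ℕ) (s t C : ℕ) → (∀ i → s ≤ i → suc i < suc t → f (suc i) < f i) →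
                    f s + suc s ≤ C → C ≤ f t + suc t → ∀ i → s ≤ i → i ≤ t → f i + suc i ≡ C
pinned-decreasing f s t C desc first last i s≤i i≤t = ≤-antisym upper lower
  where
  e = proj₁ (m≤n⇒∃[o]m+o≡n s≤i)
  s+e≡i : s + e ≡ i
  s+e≡i = proj₂ (m≤n⇒∃[o]m+o≡n s≤i)
  e′ = proj₁ (m≤n⇒∃[o]m+o≡n i≤t)
  i+e′≡t : i + e′ ≡ t
  i+e′≡t = proj₂ (m≤n⇒∃[o]m+o≡n i≤t)
  rearrange : ∀ x y z → x + suc (y + z) ≡ (x + z) + suc y
  rearrange = solve-∀
  drop-from-s : f i + e ≤ f s
  drop-from-s = subst (λ z → f z + e ≤ f s) s+e≡i
    (descending-drop f s (suc t) desc s e ≤-refl (s≤s (subst (_≤ t) (sym s+e≡i) i≤t)))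
  drop-to-t : f t + e′ ≤ f i
  drop-to-t = subst (λ z → f z + e′ ≤ f i) i+e′≡t
    (descending-drop f s (suc t) desc i e′ s≤i (s≤s (≤-reflexive i+e′≡t)))
  upper : f i + suc i ≤ C
  upper = begin
    f i + suc i         ≡⟨ cong (λ z → f i + suc z) (sym s+e≡i) ⟩
    f i + suc (s + e)   ≡⟨ rearrange (f i) s e ⟩
    (f i + e) + suc s   ≤⟨ +-monoˡ-≤ (suc s) drop-from-s ⟩
    f s + suc s         ≤⟨ first ⟩
    C                   ∎
    where open ≤-Reasoning
  lower : C ≤ f i + suc i
  lower = begin
    C                   ≤⟨ last ⟩
    f t + suc t         ≡⟨ cong (λ z → f t + suc z) (sym i+e′≡t) ⟩
    f t + suc (i + e′)  ≡⟨ rearrange (f t) i e′ ⟩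
    (f t + e′) + suc i  ≤⟨ +-monoˡ-≤ (suc i) drop-to-t ⟩
    f i + suc i         ∎
    where open ≤-Reasoning

-- Reading p from the left:
-- the positions with p i = n-1-i form run₁ = [0, a).  The largest remaining
-- value m = n-1-a sits at some position j > a; avoiding 231 forces every value
-- in [a, j) below every value in [j, n), and avoiding 123 forces both [a, j)
-- and [j, n) to be decreasing.  Counting values then pins down the runs,
-- with b = j - a.
module Characterisation {n : ℕ} (p : Vec (Fin n) n) (p-perm : IsPerm n p)
                        (av123 : Avoids p pat123) (av231 : Avoids p pat231) where
  val : ℕ → ℕ
  val = valueAt p

  val-fromℕ< : ∀ {i} (i<n : i < n) → val i ≡ toℕ (lookup p (fromℕ< i<n))
  val-fromℕ< {i} i<n = trans (cong val (sym (FinP.toℕ-fromℕ< i<n))) (valueAt-lookup p (fromℕ< i<n))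

  val-< : ∀ {i} → i < n → val i < n
  val-< i<n = subst (_< n) (sym (val-fromℕ< i<n)) (FinP.toℕ<n _)

  val-injective : ∀ {i j} → i < n → j < n → val i ≡ val j → i ≡ j
  val-injective {i} {j} i<n j<n eq =
    trans (sym (FinP.toℕ-fromℕ< i<n))
      (trans (cong toℕ (p-perm (FinP.toℕ-injective (trans (sym (val-fromℕ< i<n)) (trans eq (val-fromℕ< j<n))))))
             (FinP.toℕ-fromℕ< j<n))

  val-flip : ∀ {i k} → i < n → k < n → i ≢ k → ¬ (val i < val k) → val k < val i
  val-flip i<n k<n i≢k not-lt with m≤n⇒m<n∨m≡n (≮⇒≥ not-lt)
  ... | inj₁ lt = lt
  ... | inj₂ eq = ⊥-elim (i≢k (val-injective i<n k<n (sym eq)))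

  no-123 : ∀ {i j k} → i < j → j < k → k < n → val i < val j → val j < val k → ⊥
  no-123 {i} {j} {k} i<j j<k k<n v₁ v₂ =
    av123 (Occurrences.build p pat123 pat123-injective i<j j<k k<n order)
    where
    order : ∀ s t → lookup pat123 s <ᶠ lookup pat123 t → val (choose3 i j k s) < val (choose3 i j k t)
    order fz (fs fz) _ = v₁
    order fz (fs (fs fz)) _ = <-trans v₁ v₂
    order (fs fz) (fs (fs fz)) _ = v₂
    order fz fz ()
    order (fs fz) fz ()
    order (fs fz) (fs fz) (s≤s ())
    order (fs (fs fz)) fz ()
    order (fs (fs fz)) (fs fz) (s≤s ())
    order (fs (fs fz)) (fs (fs fz)) (s≤s (s≤s ()))

  no-231 : ∀ {i j k} → i < j → j < k → k < n → val k < val i → val i < val j → ⊥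
  no-231 {i} {j} {k} i<j j<k k<n v₁ v₂ =
    av231 (Occurrences.build p pat231 pat231-injective i<j j<k k<n order)
    where
    order : ∀ s t → lookup pat231 s <ᶠ lookup pat231 t → val (choose3 i j k s) < val (choose3 i j k t)
    order fz (fs fz) _ = v₂
    order (fs (fs fz)) fz _ = v₁
    order (fs (fs fz)) (fs fz) _ = <-trans v₁ v₂
    order fz fz (s≤s ())
    order fz (fs (fs fz)) ()
    order (fs fz) fz (s≤s ())
    order (fs fz) (fs fz) (s≤s (s≤s ()))
    order (fs fz) (fs (fs fz)) ()
    order (fs (fs fz)) (fs (fs fz)) ()

  InRun₁ : ℕ → Set
  InRun₁ i = val i + suc i ≡ n

  longest-prefix : ∀ t m → m + t ≡ n → (∀ i → i < m → InRun₁ i) →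
                   Σ ℕ λ a → a ≤ n × (∀ i → i < a → InRun₁ i) × (a < n → ¬ InRun₁ a)
  longest-prefix zero m m+0≡n prefix = m , ≤-reflexive m≡n , prefix , λ m<n → ⊥-elim (<-irrefl m≡n m<n)
    where m≡n = trans (sym (+-identityʳ m)) m+0≡n
  longest-prefix (suc t) m eq prefix with val m + suc m ≟ n
  ... | yes m-in = longest-prefix t (suc m) (trans (sym (+-suc m t)) eq) extended
    where
    extended : ∀ i → i < suc m → InRun₁ i
    extended i i<sm with m≤n⇒m<n∨m≡n (s≤s⁻¹ i<sm)
    ... | inj₁ i<m = prefix i i<m
    ... | inj₂ refl = m-in
  ... | no m-out = m , subst (m ≤_) eq (m≤m+n m (suc t)) , prefix , λ _ → m-out

  -- The rest of the permutation, after a maximal proper run₁ = [0, a);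
  -- m = n - 1 - a is the largest value not used by run₁.
  module AfterRun₁ (a m : ℕ) (a+1+m≡n : a + suc m ≡ n) (run₁ : ∀ i → i < a → InRun₁ i) (a-out : ¬ InRun₁ a) where
    a<n : a < n
    a<n = subst (a <_) a+1+m≡n (m<m+n a z<s)

    -- Values above m are used up by run₁.
    values-≤m : ∀ k → a ≤ k → k < n → val k ≤ m
    values-≤m k a≤k k<n with val k ≤? m
    ... | yes le = le
    ... | no gt = ⊥-elim (<⇒≱ (<-≤-trans i<a a≤k) (≤-reflexive (sym i≡k)))
      where
      witness = m<n⇒∃[o]m+suc[o]≡n (val-< k<n)
      i = proj₁ witness
      i<a : i < a
      i<a = balance-< {a} {i} {suc m} {suc (val k)} (trans a+1+m≡n (sym (trans (swap-suc i (val k)) (proj₂ witness))))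
              (s≤s (≰⇒> gt))
      i≡k : i ≡ k
      i≡k = val-injective (<-trans i<a a<n) k<n (+-cancelʳ-≡ _ _ _ (trans (run₁ i i<a) (sym (proj₂ witness))))

    -- The value m occurs (pigeonhole: otherwise m+1 positions share m values).
    peak : Σ ℕ λ j → j < n × val j ≡ m
    peak with anyUpTo? (λ j → val j ≟ m) n
    ... | yes found = found
    ... | no absent = ⊥-elim (<-irrefl refl (FinP.injective⇒≤ squeeze-injective))
      where
      a+k<n : ∀ (k : Fin (suc m)) → a + toℕ k < n
      a+k<n k = subst (a + toℕ k <_) a+1+m≡n (+-monoʳ-< a (FinP.toℕ<n k))
      below-m : ∀ (k : Fin (suc m)) → val (a + toℕ k) < m
      below-m k with m≤n⇒m<n∨m≡n (values-≤m (a + toℕ k) (m≤m+n a _) (a+k<n k))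
      ... | inj₁ lt = lt
      ... | inj₂ eq = ⊥-elim (absent (a + toℕ k , a+k<n k , eq))
      squeeze : Fin (suc m) → Fin m
      squeeze k = fromℕ< (below-m k)
      squeeze-injective : ∀ {k k'} → squeeze k ≡ squeeze k' → k ≡ k'
      squeeze-injective {k} {k'} eq = FinP.toℕ-injective (+-cancelˡ-≡ a _ _ (val-injective (a+k<n k) (a+k<n k')
        (trans (sym (FinP.toℕ-fromℕ< (below-m k))) (trans (cong toℕ eq) (FinP.toℕ-fromℕ< (below-m k'))))))

    j : ℕ
    j = proj₁ peak
    j<n : j < n
    j<n = proj₁ (proj₂ peak)
    val-j : val j ≡ m
    val-j = proj₂ (proj₂ peak)

    -- j lies beyond a: before a the values are too big, and j = a would put a in run₁.
    a<j : a < j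
    a<j with <-cmp a j
    ... | tri< a<j _ _ = a<j
    ... | tri≈ _ a≡j _ = ⊥-elim (a-out (begin
      val a + suc a  ≡⟨ cong (λ z → val z + suc z) a≡j ⟩
      val j + suc j  ≡⟨ cong (λ z → z + suc j) val-j ⟩
      m + suc j      ≡⟨ swap-suc m j ⟩
      j + suc m      ≡⟨ cong (_+ suc m) (sym a≡j) ⟩
      a + suc m      ≡⟨ a+1+m≡n ⟩
      n              ∎))
      where open ≡-Reasoning
    ... | tri> _ _ j<a = ⊥-elim (<-irrefl (+-cancelʳ-≡ (suc m) j a j+1+m≡a+1+m) j<a)
      where
      j+1+m≡a+1+m : j + suc m ≡ a + suc m
      j+1+m≡a+1+m = trans (swap-suc j m) (trans (cong (_+ suc j) (sym val-j)) (trans (run₁ j j<a) (sym a+1+m≡n)))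

    below-peak : ∀ k → a ≤ k → k < n → k ≢ j → val k < m
    below-peak k a≤k k<n k≢j with m≤n⇒m<n∨m≡n (values-≤m k a≤k k<n)
    ... | inj₁ lt = lt
    ... | inj₂ eq = ⊥-elim (k≢j (val-injective k<n j<n (trans eq (sym val-j))))

    -- Avoiding 231 (with the peak as the middle entry): [a, j) lies below [j, n).
    left-below-right : ∀ i k → a ≤ i → i < j → j ≤ k → k < n → val i < val k
    left-below-right i k a≤i i<j j≤k k<n with m≤n⇒m<n∨m≡n j≤k
    ... | inj₂ refl = subst (val i <_) (sym val-j) i-below
      where i-below = below-peak i a≤i (<-trans i<j j<n) (<⇒≢ i<j)
    ... | inj₁ j<k with val i <? val k
    ...   | yes lt = lt
    ...   | no not-lt = ⊥-elim (no-231 i<j j<k k<n (val-flip i<n k<n (<⇒≢ (<-trans i<j j<k)) not-lt)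
                          (subst (val i <_) (sym val-j) (below-peak i a≤i i<n (<⇒≢ i<j))))
      where i<n = <-trans i<j j<n

    -- Avoiding 123 (with a position of [j, n) as the last entry): [a, j) decreases.
    left-decreasing : ∀ i → a ≤ i → suc i < j → val (suc i) < val i
    left-decreasing i a≤i i+1<j with val (suc i) <? val i
    ... | yes lt = lt
    ... | no not-lt = ⊥-elim (no-123 (n<1+n i) i+1<j j<n
                        (val-flip i+1<n i<n 1+n≢n not-lt)
                        (left-below-right (suc i) j (m≤n⇒m≤1+n a≤i) i+1<j ≤-refl j<n))
      where
      i+1<n = <-trans i+1<j j<n
      i<n = <-trans (n<1+n i) i+1<n

    -- Avoiding 123 (with position a as the first entry): [j, n) decreases.
    right-decreasing : ∀ k → j ≤ k → suc k < n → val (suc k) < val k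
    right-decreasing k j≤k k+1<n with m≤n⇒m<n∨m≡n j≤k
    ... | inj₂ refl = subst (val (suc j) <_) (sym val-j)
                        (below-peak (suc j) (<⇒≤ (<-trans a<j (n<1+n j))) k+1<n 1+n≢n)
    ... | inj₁ j<k with val (suc k) <? val k
    ...   | yes lt = lt
    ...   | no not-lt = ⊥-elim (no-123 (<-trans a<j j<k) (n<1+n k) k+1<n
                          (left-below-right a k ≤-refl a<j (<⇒≤ j<k) k<n)
                          (val-flip k+1<n k<n 1+n≢n not-lt))
      where k<n = <-trans (n<1+n k) k+1<n

    -- Run₂ = [a, j) and run₃ = [j, n); the last position is n - 1 = a + m.
    b : ℕ
    b = proj₁ (m≤n⇒∃[o]m+o≡n (<⇒≤ a<j))
    a+b≡j : a + b ≡ j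
    a+b≡j = proj₂ (m≤n⇒∃[o]m+o≡n (<⇒≤ a<j))

    last : ℕ
    last = a + m
    last+1≡n : suc last ≡ n
    last+1≡n = trans (sym (+-suc a m)) a+1+m≡n
    j≤last : j ≤ last
    j≤last = s≤s⁻¹ (subst (j <_) (sym last+1≡n) j<n)
    last<n : last < n
    last<n = subst (last <_) last+1≡n (n<1+n last)

    -- From the peak m the last value has dropped by last - j = m - b steps.
    val-last≤b : val last ≤ b
    val-last≤b = +-cancelʳ-≤ e (val last) b (subst (val last + e ≤_) (sym b+e≡m) dropped)
      where
      e = proj₁ (m≤n⇒∃[o]m+o≡n j≤last)
      j+e≡last : j + e ≡ last
      j+e≡last = proj₂ (m≤n⇒∃[o]m+o≡n j≤last)
      b+e≡m : b + e ≡ m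
      b+e≡m = +-cancelˡ-≡ a _ _ (trans (sym (+-assoc a b e)) (trans (cong (_+ e) a+b≡j) j+e≡last))
      dropped : val last + e ≤ m
      dropped = subst (λ z → val z + e ≤ m) j+e≡last
        (subst (val (j + e) + e ≤_) val-j (descending-drop val j n right-decreasing j e ≤-refl (subst (_< n) (sym j+e≡last) last<n)))

    val-a<val-last : val a < val last
    val-a<val-last = left-below-right a last ≤-refl a<j j≤last last<n

    run₂-exact : ∀ i → a ≤ i → i < j → val i + suc i ≡ a + b
    run₂-exact i a≤i i<j = pinned-decreasing val a j′ (a + b) decreasing first last-ok i a≤i (s≤s⁻¹ (subst (i <_) (sym j′+1≡j) i<j))
      where
      j′ = pred j
      j′+1≡j : suc j′ ≡ j
      j′+1≡j = suc-pred j {{>-nonZero (<-≤-trans (s≤s z≤n) a<j)}}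
      decreasing : ∀ i → a ≤ i → suc i < suc j′ → val (suc i) < val i
      decreasing i a≤i lt = left-decreasing i a≤i (subst (suc i <_) j′+1≡j lt)
      first : val a + suc a ≤ a + b
      first = subst (_≤ a + b) (sym (+-suc (val a) a))
                (subst (suc (val a) + a ≤_) (+-comm b a) (+-monoˡ-≤ a (<-≤-trans val-a<val-last val-last≤b)))
      last-ok : a + b ≤ val j′ + suc j′
      last-ok = subst (_≤ val j′ + suc j′) (trans j′+1≡j (sym a+b≡j)) (m≤n+m (suc j′) (val j′))

    run₃-exact : ∀ k → j ≤ k → k < n → val k + suc k ≡ n + b
    run₃-exact k j≤k k<n = pinned-decreasing val j last (n + b) decreasing first last-ok k j≤k (s≤s⁻¹ (subst (k <_) (sym last+1≡n) k<n))
      where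
      decreasing : ∀ k → j ≤ k → suc k < suc last → val (suc k) < val k
      decreasing k j≤k lt = right-decreasing k j≤k (subst (suc k <_) last+1≡n lt)
      rearrange : ∀ a b m → m + suc (a + b) ≡ (a + suc m) + b
      rearrange = solve-∀
      first : val j + suc j ≤ n + b
      first = ≤-reflexive (trans (cong₂ (λ v w → v + suc w) val-j (sym a+b≡j))
                (trans (rearrange a b m) (cong (_+ b) a+1+m≡n)))
      b≤val-last : b ≤ val last
      b≤val-last = +-cancelʳ-≤ a b (val last)
        (subst (_≤ val last + a) (trans (sym (+-suc (val a) a)) (trans (run₂-exact a ≤-refl a<j) (+-comm a b)))
          (+-monoˡ-≤ a val-a<val-last))
      last-ok : n + b ≤ val last + suc last
      last-ok = subst (n + b ≤_) (cong (val last +_) (sym last+1≡n))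
                  (subst (_≤ val last + n) (+-comm b n) (+-monoˡ-≤ n b≤val-last))

    layered-shape : Σ ℕ λ a′ → Σ ℕ λ b′ → a′ + b′ ≤ n × (∀ i → i < n → val i ≡ layered n a′ b′ i)
    layered-shape = a , b , a+b≤n , agree
      where
      a+b≤n = subst (_≤ n) (sym a+b≡j) (<⇒≤ j<n)
      open Runs {n} {a} {b} a+b≤n
      agree : ∀ i → i < n → val i ≡ layered n a b i
      agree i i<n with run a b i
      ... | in₁ h = +-cancelʳ-≡ _ _ _ (trans (run₁ i h) (sym (run₁-sum h)))
      ... | in₂ h1 h2 = +-cancelʳ-≡ _ _ _ (trans (run₂-exact i h1 (subst (i <_) a+b≡j h2)) (sym (run₂-sum h1 h2)))
      ... | in₃ h = +-cancelʳ-≡ _ _ _ (trans (run₃-exact i (subst (_≤ i) a+b≡j h) i<n) (sym (run₃-sum h i<n)))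

  layered-shape : Σ ℕ λ a → Σ ℕ λ b → a + b ≤ n × (∀ i → i < n → val i ≡ layered n a b i)
  layered-shape with longest-prefix n 0 refl (λ _ ())
  ... | a , a≤n , run₁ , a-out with m≤n⇒m<n∨m≡n a≤n
  ...   | inj₂ a≡n = n , 0 , ≤-reflexive (+-identityʳ n) , λ i i<n →
            +-cancelʳ-≡ _ _ _ (trans (run₁ i (subst (i <_) (sym a≡n) i<n))
              (sym (Runs.run₁-sum {n} {n} {0} (≤-reflexive (+-identityʳ n)) i<n)))
  ...   | inj₁ a<n = AfterRun₁.layered-shape a (proj₁ split) (proj₂ split) run₁ (a-out a<n)
    where split = m<n⇒∃[o]m+suc[o]≡n a<n

avoider-is-layered : ∀ {n} (p : Vec (Fin n) n) → IsPerm n p → Avoids p pat123 → Avoids p pat231 →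
                     Σ ℕ λ a → Σ ℕ λ b → a + b ≤ n × p ≡ layeredPerm n a b
avoider-is-layered {n} p p-perm av123 av231 with Characterisation.layered-shape p p-perm av123 av231
... | a , b , a+b≤n , agree = a , b , a+b≤n ,
      trans (sym (VecP.tabulate∘lookup p))
       (trans (VecP.tabulate-cong (λ i → FinP.toℕ-injective
           (trans (sym (valueAt-lookup p i))
             (trans (agree (toℕ i) (FinP.toℕ<n i)) (sym (LayeredPerm.lookup-layeredPerm {n} {a} {b} a+b≤n i))))))
        (VecP.tabulate∘lookup (layeredPerm n a b)))

module Mod (M : ℕ) {{_ : NonZero M}} where
  infix 4 _≈_
  _≈_ : ℕ → ℕ → Set
  x ≈ y = x % M ≡ y % M

  ≈-sym : ∀ {x y} → x ≈ y → y ≈ x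
  ≈-sym = sym

  ≈-trans : ∀ {x y z} → x ≈ y → y ≈ z → x ≈ z
  ≈-trans = trans

  ≡⇒≈ : ∀ {x y} → x ≡ y → x ≈ y
  ≡⇒≈ refl = refl

  ≈-+ˡ : ∀ {x y} z → x ≈ y → x + z ≈ y + z
  ≈-+ˡ {x} {y} z e = trans (%-distribˡ-+ x z M) (trans (cong (λ w → (w + z % M) % M) e) (sym (%-distribˡ-+ y z M)))

  ≈-+ʳ : ∀ {x y} z → x ≈ y → z + x ≈ z + y
  ≈-+ʳ {x} {y} z e = trans (cong (_% M) (+-comm z x)) (trans (≈-+ˡ z e) (cong (_% M) (+-comm y z)))

  %≈ : ∀ x → x % M ≈ x
  %≈ x = m%n%n≡m%n x M

  +M≈ : ∀ x → x + M ≈ x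
  +M≈ x = [m+n]%n≡m%n x M

  +kM≈ : ∀ x k → x + k * M ≈ x
  +kM≈ x k = [m+kn]%n≡m%n x k M

  ≈-eq : ∀ {x y} → x < M → y < M → x ≈ y → x ≡ y
  ≈-eq {x} {y} x<M y<M e = trans (sym (m<n⇒m%n≡m x<M)) (trans e (m<n⇒m%n≡m y<M))

  -- Cancellation: add the complement of z modulo M on both sides.
  ≈-cancel : ∀ {x y} z → x + z ≈ y + z → x ≈ y
  ≈-cancel {x} {y} z e = ≈-trans (≈-sym (undo x)) (≈-trans (≈-+ˡ c e) (undo y))
    where
    r = z % M
    c = M ∸ r
    r+c≡M : r + c ≡ M
    r+c≡M = m+[n∸m]≡n (<⇒≤ (m%n<n z M))
    undo : ∀ w → (w + z) + c ≈ w
    undo w = ≈-trans (≈-+ˡ c (≈-+ʳ w (≈-sym (%≈ z))))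
               (≈-trans (≡⇒≈ (trans (+-assoc w r c) (cong (w +_) r+c≡M))) (+M≈ w))

solve-congruence : (m e : ℕ) {{_ : NonZero m}} → Cop.Coprime e m → ∀ y → Σ ℕ λ j → j < m × (j * e) % m ≡ y % m
solve-congruence m e cop y with Cop.coprime-Bézout cop
... | Bézout.+- x z eq = (y * x) % m , m%n<n _ m , trans (reduce (y * x)) solves
  where
  open Mod m
  reduce : ∀ j → ((j % m) * e) % m ≡ (j * e) % m
  reduce j = trans (%-distribˡ-* (j % m) e m) (trans (cong (λ z → (z * (e % m)) % m) (m%n%n≡m%n j m)) (sym (%-distribˡ-* j e m)))
  expand : ∀ y x z m → y * (1 + z * m) ≡ y + (y * z) * m
  expand = solve-∀
  solves : (y * x) * e ≈ y
  solves = ≈-trans (≡⇒≈ (trans (*-assoc y x e) (trans (cong (y *_) (sym eq)) (expand y x z m)))) (+kM≈ y (y * z))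
... | Bézout.-+ x z eq = (w * x) % m , m%n<n _ m , trans (reduce (w * x)) solves
  where
  open Mod m
  reduce : ∀ j → ((j % m) * e) % m ≡ (j * e) % m
  reduce j = trans (%-distribˡ-* (j % m) e m) (trans (cong (λ z → (z * (e % m)) % m) (m%n%n≡m%n j m)) (sym (%-distribˡ-* j e m)))
  -- w = -y modulo m, and w x e ≡ -w
  w = m ∸ y % m
  y+w≡m : y % m + w ≡ m
  y+w≡m = m+[n∸m]≡n (<⇒≤ (m%n<n y m))
  expand : ∀ w x e → (w * x) * e + w ≡ w * (1 + x * e)
  expand = solve-∀
  wxe+w : (w * x) * e + w ≡ (w * z) * m
  wxe+w = trans (expand w x e) (trans (cong (w *_) eq) (sym (*-assoc w z m)))
  solves : (w * x) * e ≈ y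
  solves = ≈-trans (≈-cancel w (≈-trans (≡⇒≈ wxe+w) (≈-trans (+kM≈ 0 (w * z)) (≈-trans (≈-sym (+M≈ 0)) (≡⇒≈ (sym y+w≡m))))))
             (%≈ y)

iterN : (ℕ → ℕ) → ℕ → ℕ → ℕ
iterN g zero x = x
iterN g (suc k) x = g (iterN g k x)

iter-add : ∀ g s t x → iterN g (s + t) x ≡ iterN g s (iterN g t x)
iter-add g zero t x = refl
iter-add g (suc s) t x = cong g (iter-add g s t x)

iter-suc-inner : ∀ g j x → iterN g (suc j) x ≡ iterN g j (g x)
iter-suc-inner g j x = trans (cong (λ z → iterN g z x) (+-comm 1 j)) (iter-add g j 1 x)

iter-mul : ∀ g e k x → iterN g e x ≡ x → iterN g (k * e) x ≡ x
iter-mul g e zero x h = refl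
iter-mul g e (suc k) x h = trans (iter-add g e (k * e) x) (trans (cong (iterN g e) (iter-mul g e k x h)) h)

-- g is transitive on [0, M): every point reaches every point.  For a
-- permutation this says it is a single cycle.
TransitiveOn : ℕ → (ℕ → ℕ) → Set
TransitiveOn M g = ∀ u v → u < M → v < M → Σ ℕ λ t → iterN g t u ≡ v

transitive-from-base-point : (M : ℕ) (U : ℕ → ℕ) (u₀ N : ℕ) → iterN U (suc N) u₀ ≡ u₀ →
                             (∀ v → v < M → Σ ℕ λ t → iterN U t u₀ ≡ v) → TransitiveOn M U
transitive-from-base-point M U u₀ N period reach u v u<M v<M with reach u u<M | reach v v<M
... | s , u≡ | t , v≡ = t + N * s , (begin
  iterN U (t + N * s) u                       ≡⟨ cong (iterN U (t + N * s)) (sym u≡) ⟩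
  iterN U (t + N * s) (iterN U s u₀)          ≡⟨ sym (iter-add U (t + N * s) s u₀) ⟩
  iterN U (t + N * s + s) u₀                  ≡⟨ cong (λ z → iterN U z u₀) (regroup t N s) ⟩
  iterN U (t + s * suc N) u₀                  ≡⟨ iter-add U t (s * suc N) u₀ ⟩
  iterN U t (iterN U (s * suc N) u₀)          ≡⟨ cong (iterN U t) (iter-mul U (suc N) s u₀ period) ⟩
  iterN U t u₀                                ≡⟨ v≡ ⟩
  v                                           ∎)
  where
  open ≡-Reasoning
  regroup : ∀ t N s → t + N * s + s ≡ t + s * suc N
  regroup = solve-∀

invariant-residue-blocks-transitivity :
  (M : ℕ) (U : ℕ → ℕ) (G r : ℕ) {{_ : NonZero G}} → (∀ x → x < M → U x < M) →
  (∀ x → x < M → x % G ≡ r → U x % G ≡ r) →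
  ∀ u₀ v → u₀ < M → v < M → u₀ % G ≡ r → v % G ≢ r → ¬ TransitiveOn M U
invariant-residue-blocks-transitivity M U G r U-< invariant u₀ v u₀<M v<M u₀-in v-out transitive
  with transitive u₀ v u₀<M v<M
... | t , reached = v-out (subst (λ z → z % G ≡ r) reached (proj₁ (stays t)))
  where
  stays : ∀ t → iterN U t u₀ % G ≡ r × iterN U t u₀ < M
  stays zero = u₀-in , u₀<M
  stays (suc t) = invariant _ (proj₂ (stays t)) (proj₁ (stays t)) , U-< _ (proj₂ (stays t))

module TransitiveMap (M : ℕ) (U : ℕ → ℕ) (U-< : ∀ u → u < M → U u < M)
                     (U-injective : ∀ u v → u < M → v < M → U u ≡ U v → u ≡ v)
                     (transitive : TransitiveOn M U) where

  iterate-< : ∀ t u → u < M → iterN U t u < M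
  iterate-< zero u u<M = u<M
  iterate-< (suc t) u u<M = U-< _ (iterate-< t u u<M)

  iterate-injective : ∀ t u v → u < M → v < M → iterN U t u ≡ iterN U t v → u ≡ v
  iterate-injective zero u v u<M v<M e = e
  iterate-injective (suc t) u v u<M v<M e =
    iterate-injective t u v u<M v<M (U-injective _ _ (iterate-< t u u<M) (iterate-< t v v<M) e)

  reduce-mod-period : ∀ e {{_ : NonZero e}} u₀ → iterN U e u₀ ≡ u₀ → ∀ t → iterN U t u₀ ≡ iterN U (t % e) u₀
  reduce-mod-period e u₀ period t =
    trans (cong (λ z → iterN U z u₀) (m≡m%n+[m/n]*n t e))
      (trans (iter-add U (t % e) _ u₀) (cong (iterN U (t % e)) (iter-mul U e (t / e) u₀ period)))

  -- A period e of a point is at least M, since its orbit is everything.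
  period-≥M : ∀ u₀ → u₀ < M → ∀ e → iterN U (suc e) u₀ ≡ u₀ → M ≤ suc e
  period-≥M u₀ u₀<M e period = FinP.injective⇒≤ index-injective
    where
    steps : Fin M → ℕ
    steps v = proj₁ (transitive u₀ (toℕ v) u₀<M (FinP.toℕ<n v))
    index : Fin M → Fin (suc e)
    index v = fromℕ< (m%n<n (steps v) (suc e))
    point≡ : ∀ v → iterN U (toℕ (index v)) u₀ ≡ toℕ v
    point≡ v = trans (cong (λ z → iterN U z u₀) (FinP.toℕ-fromℕ< (m%n<n (steps v) (suc e))))
                 (trans (sym (reduce-mod-period (suc e) u₀ period (steps v))) (proj₂ (transitive u₀ (toℕ v) u₀<M (FinP.toℕ<n v))))
    index-injective : ∀ {v w} → index v ≡ index w → v ≡ w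
    index-injective {v} {w} eq = FinP.toℕ-injective (trans (sym (point≡ v)) (trans (cong (λ k → iterN U (toℕ k) u₀) eq) (point≡ w)))

  -- Every point returns after exactly M steps: among U⁰ u₀, …, U^M u₀ two
  -- coincide, which gives a period of at most M.
  period-M : ∀ u₀ → u₀ < M → iterN U M u₀ ≡ u₀
  period-M u₀ u₀<M with FinP.pigeonhole (n<1+n M) (λ (k : Fin (suc M)) → fromℕ< (iterate-< (toℕ k) u₀ u₀<M))
  ... | i , j , i<j , eq = subst (λ z → iterN U z u₀ ≡ u₀) (≤-antisym r+1≤M (period-≥M u₀ u₀<M r returns)) returns
    where
    r = proj₁ (m<n⇒∃[o]m+suc[o]≡n i<j)
    i+1+r≡j : toℕ i + suc r ≡ toℕ j
    i+1+r≡j = proj₂ (m<n⇒∃[o]m+suc[o]≡n i<j)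
    r+1≤M : suc r ≤ M
    r+1≤M = ≤-trans (m≤n+m (suc r) (toℕ i)) (subst (_≤ M) (sym i+1+r≡j) (s≤s⁻¹ (FinP.toℕ<n j)))
    same : iterN U (toℕ i) u₀ ≡ iterN U (toℕ j) u₀
    same = trans (sym (FinP.toℕ-fromℕ< (iterate-< (toℕ i) u₀ u₀<M)))
             (trans (cong toℕ eq) (FinP.toℕ-fromℕ< (iterate-< (toℕ j) u₀ u₀<M)))
    returns : iterN U (suc r) u₀ ≡ u₀
    returns = iterate-injective (toℕ i) _ _ (iterate-< (suc r) u₀ u₀<M) u₀<M
                (trans (sym (iter-add U (toℕ i) (suc r) u₀))
                  (trans (cong (λ z → iterN U z u₀) i+1+r≡j) (sym same)))

  periods-below-2M : ∀ u₀ → u₀ < M → ∀ s → iterN U s u₀ ≡ u₀ → s < M + M → s ≡ 0 ⊎ s ≡ M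
  periods-below-2M u₀ u₀<M zero _ _ = inj₁ refl
  periods-below-2M u₀ u₀<M (suc s) period s<2M with suc s <? M
  ... | yes s<M = ⊥-elim (<⇒≱ s<M (period-≥M u₀ u₀<M s period))
  ... | no s≮M with m≤n⇒∃[o]m+o≡n (≮⇒≥ s≮M)
  ...   | zero , M+0≡s = inj₂ (trans (sym M+0≡s) (+-identityʳ M))
  ...   | suc r , M+r≡s = ⊥-elim (<⇒≱ r<M (period-≥M u₀ u₀<M r returns))
    where
    r<M : suc r < M
    r<M = +-cancelˡ-< M (suc r) M (subst (_< M + M) (sym M+r≡s) s<2M)
    returns : iterN U (suc r) u₀ ≡ u₀
    returns = trans (sym (cong (iterN U (suc r)) (period-M u₀ u₀<M)))
                (trans (sym (iter-add U (suc r) M u₀)) (trans (cong (λ z → iterN U z u₀) (trans (+-comm (suc r) M) M+r≡s)) period))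

  reach-below-M : ∀ u₀ v → u₀ < M → v < M → Σ ℕ λ k → k < M × iterN U k u₀ ≡ v
  reach-below-M u₀ v u₀<M v<M with transitive u₀ v u₀<M v<M
  ... | t , reached = t % M , m%n<n t M , trans (sym (reduce-mod-period M u₀ (period-M u₀ u₀<M) t)) reached
    where
    instance
      M≢0 : NonZero M
      M≢0 = >-nonZero (<-≤-trans (s≤s z≤n) u₀<M)

  -- A map K with U ∘ K ∘ U = K reverses the cycle of U, i.e. acts on it as a
  -- reflection.  Two fixed points of K then lie at distance 0 or M/2 along the
  -- cycle, so K has at most two fixed points; and when M is even, a fixed
  -- point excludes an edge {w, U w} flipped by K.
  module Reversed (K : ℕ → ℕ) (reverses : ∀ x → x < M → U (K (U x)) ≡ K x) where
    iterate-reversed : ∀ j u → u < M → iterN U j (K (iterN U j u)) ≡ K u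
    iterate-reversed zero u u<M = refl
    iterate-reversed (suc j) u u<M =
      trans (iter-suc-inner U j _) (trans (cong (iterN U j) (reverses (iterN U j u) (iterate-< j u u<M))) (iterate-reversed j u u<M))

    reflected : ∀ k u → u < M → K u ≡ u → iterN U k (K (iterN U k u)) ≡ u
    reflected k u u<M fixed = trans (iterate-reversed k u u<M) fixed

    fixed-point-distance : ∀ u₀ u₁ → u₀ < M → u₁ < M → K u₀ ≡ u₀ → K u₁ ≡ u₁ →
                           Σ ℕ λ k → iterN U k u₀ ≡ u₁ × (k ≡ 0 ⊎ k + k ≡ M)
    fixed-point-distance u₀ u₁ u₀<M u₁<M fixed₀ fixed₁ with reach-below-M u₀ u₁ u₀<M u₁<M
    ... | k , k<M , reached = k , reached , distance
      where
      returns : iterN U (k + k) u₀ ≡ u₀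
      returns = begin
        iterN U (k + k) u₀               ≡⟨ iter-add U k k u₀ ⟩
        iterN U k (iterN U k u₀)         ≡⟨ cong (iterN U k) (trans reached (sym fixed₁)) ⟩
        iterN U k (K u₁)                 ≡⟨ cong (λ z → iterN U k (K z)) (sym reached) ⟩
        iterN U k (K (iterN U k u₀))     ≡⟨ reflected k u₀ u₀<M fixed₀ ⟩
        u₀                               ∎
        where open ≡-Reasoning
      distance : k ≡ 0 ⊎ k + k ≡ M
      distance with periods-below-2M u₀ u₀<M (k + k) returns (+-mono-< k<M k<M)
      ... | inj₁ k+k≡0 = inj₁ (double-injective k+k≡0)
      ... | inj₂ k+k≡M = inj₂ k+k≡M

    at-most-two-fixed-points : ∀ u₀ u₁ u₂ → u₀ < M → u₁ < M → u₂ < M → u₁ ≢ u₀ → u₂ ≢ u₀ → u₁ ≢ u₂ →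
                               K u₀ ≡ u₀ → K u₁ ≡ u₁ → K u₂ ≡ u₂ → ⊥
    at-most-two-fixed-points u₀ u₁ u₂ u₀<M u₁<M u₂<M u₁≢u₀ u₂≢u₀ u₁≢u₂ fixed₀ fixed₁ fixed₂
      with fixed-point-distance u₀ u₁ u₀<M u₁<M fixed₀ fixed₁ | fixed-point-distance u₀ u₂ u₀<M u₂<M fixed₀ fixed₂
    ... | _ , reached₁ , inj₁ refl | _ = u₁≢u₀ (sym reached₁)
    ... | _ | _ , reached₂ , inj₁ refl = u₂≢u₀ (sym reached₂)
    ... | k₁ , reached₁ , inj₂ half₁ | k₂ , reached₂ , inj₂ half₂ =
          u₁≢u₂ (trans (sym reached₁) (trans (cong (λ z → iterN U z u₀) (double-injective {k₁} {k₂} (trans half₁ (sym half₂)))) reached₂))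

    fixed-point-excludes-flipped-edge : ∀ h u₀ w → M ≡ h + h → u₀ < M → K u₀ ≡ u₀ → w < M → K (U w) ≡ w → ⊥
    fixed-point-excludes-flipped-edge h u₀ w M≡h+h u₀<M fixed w<M flipped with reach-below-M u₀ w u₀<M w<M
    ... | k , k<M , reached with periods-below-2M u₀ u₀<M (suc k + k) returns
                                   (<-≤-trans (+-monoʳ-< (suc k) (n<1+n k)) (+-mono-≤ k<M k<M))
      where
      returns : iterN U (suc k + k) u₀ ≡ u₀
      returns = begin
        iterN U (suc k + k) u₀                  ≡⟨ iter-add U (suc k) k u₀ ⟩
        iterN U (suc k) (iterN U k u₀)          ≡⟨ cong (iterN U (suc k)) (trans reached (sym flipped)) ⟩
        iterN U (suc k) (K (U w))               ≡⟨ cong (λ z → iterN U (suc k) (K (U z))) (sym reached) ⟩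
        iterN U (suc k) (K (iterN U (suc k) u₀)) ≡⟨ reflected (suc k) u₀ u₀<M fixed ⟩
        u₀                                      ∎
        where open ≡-Reasoning
    ... | inj₁ ()
    ... | inj₂ odd≡M = odd≢even k h (trans odd≡M M≡h+h)

coprime-complement : ∀ {c b M} → c + b ≡ M → Cop.Coprime b M → Cop.Coprime c M
coprime-complement {c} {b} {M} c+b≡M cop (g∣c , g∣M) = cop (∣m+n∣m⇒∣n (subst (_ ∣_) (sym c+b≡M) g∣M) g∣c , g∣M)

divisor-nonZero : ∀ {g M} .{{_ : NonZero M}} → g ∣ M → NonZero g
divisor-nonZero {g} {M} g∣M = ≢-nonZero (λ g≡0 → ≢-nonZero⁻¹ M (0∣⇒≡0 (subst (_∣ M) g≡0 g∣M)))

module Rotation (M c : ℕ) {{_ : NonZero M}} (U : ℕ → ℕ) (rotates : ∀ w → w < M → U w ≡ (w + c) % M) where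
  open Mod M

  rotation-iterate : ∀ t w → w < M → iterN U t w ≡ (w + t * c) % M
  rotation-iterate zero w w<M = sym (trans (cong (_% M) (+-identityʳ w)) (m<n⇒m%n≡m w<M))
  rotation-iterate (suc t) w w<M =
    trans (rotates _ (subst (_< M) (sym previous) (m%n<n _ M)))
      (trans (cong (λ z → (z + c) % M) previous) (trans (≈-+ˡ c (%≈ (w + t * c))) (cong (_% M) (regroup w t c))))
    where
    previous = rotation-iterate t w w<M
    regroup : ∀ w t c → w + t * c + c ≡ w + suc t * c
    regroup = solve-∀

  0<M : 0 < M
  0<M = >-nonZero⁻¹ M

  rotation-transitive : Cop.Coprime c M → TransitiveOn M U
  rotation-transitive cop = transitive-from-base-point M U 0 (pred M) period reach
    where
    reach : ∀ v → v < M → Σ ℕ λ t → iterN U t 0 ≡ v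
    reach v v<M with solve-congruence M c cop v
    ... | j , _ , j*c≈v = j , trans (rotation-iterate j 0 0<M) (trans j*c≈v (m<n⇒m%n≡m v<M))
    period : iterN U (suc (pred M)) 0 ≡ 0
    period = trans (cong (λ z → iterN U z 0) (suc-pred M))
               (trans (rotation-iterate M 0 0<M) (trans (cong (_% M) (*-comm M c)) (m*n%n≡0 c M)))

  -- Multiples of a common divisor G of c and M form a U-invariant class
  -- that does not contain 1.
  rotation-transitive⇒coprime : TransitiveOn M U → Cop.Coprime c M
  rotation-transitive⇒coprime transitive {G} (G∣c , G∣M) = ∣1⇒≡1 G∣1
    where
    instance
      G≢0 : NonZero G
      G≢0 = divisor-nonZero G∣M
    U-< : ∀ x → x < M → U x < M
    U-< x x<M = subst (_< M) (sym (rotates x x<M)) (m%n<n _ M)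
    invariant : ∀ x → x < M → x % G ≡ 0 → U x % G ≡ 0
    invariant x x<M x%G≡0 = subst (λ z → z % G ≡ 0) (sym (rotates x x<M))
      (n∣m⇒m%n≡0 _ G (%-presˡ-∣ (∣m∣n⇒∣m+n (m%n≡0⇒n∣m x G x%G≡0) G∣c) G∣M))
    G∣1 : G ∣ 1
    G∣1 with M ≟ 1
    ... | yes M≡1 = subst (G ∣_) M≡1 G∣M
    ... | no M≢1 with 1 % G ≟ 0
    ...   | yes 1%G≡0 = m%n≡0⇒n∣m 1 G 1%G≡0
    ...   | no 1%G≢0 = ⊥-elim (invariant-residue-blocks-transitivity M U G 0 U-< invariant 0 1 0<M
                         (≤∧≢⇒< 0<M (M≢1 ∘ sym)) (n∣m⇒m%n≡0 0 G (G ∣0)) 1%G≢0 transitive)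

swap01 : ℕ → ℕ
swap01 zero = 1
swap01 (suc zero) = 0
swap01 (suc (suc x)) = suc (suc x)

swap01-id : ∀ {y} → 2 ≤ y → swap01 y ≡ y
swap01-id {suc (suc y)} _ = refl
swap01-id {suc zero} (s≤s ())

double∣ : ∀ {g m} → g ∣ m → g + g ∣ m + m
double∣ {g} {m} (divides q eq) = divides q (trans (cong₂ _+_ eq eq) (sym (*-distribˡ-+ q g g)))

-- A rotation of [0, 2m) by the even amount c = 2(m - i), followed by swapping
-- 0 and 1.  The rotation preserves parity, and the swap links the even and
-- odd cycles; the map is transitive exactly when i is coprime to m.
module FlippedRotation (m i M : ℕ) {{_ : NonZero m}} {{_ : NonZero M}} (M≡2m : M ≡ m + m) (i≤m : i ≤ m)
                       (U : ℕ → ℕ) where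
  e : ℕ
  e = m ∸ i
  e+i≡m : e + i ≡ m
  e+i≡m = m∸n+n≡m i≤m
  c : ℕ
  c = e + e
  c+2i≡M : c + (i + i) ≡ M
  c+2i≡M = trans (regroup e i) (trans (cong₂ _+_ e+i≡m e+i≡m) (sym M≡2m))
    where
    regroup : ∀ e i → (e + e) + (i + i) ≡ (e + i) + (e + i)
    regroup = solve-∀
  open Mod M

  module _ (flip-rotates : ∀ w → w < M → U w ≡ swap01 ((w + c) % M)) where
    rotated : ℕ → ℕ → ℕ
    rotated j s = (s + j * c) % M

    rotated-form : ∀ j s → s < 2 → rotated j s ≡ s + (((j * e) % m) + ((j * e) % m))
    rotated-form j s s<2 = trans (cong (λ z → (s + z) % M) (double-product j e)) (halve (j * e))
      where
      double-product : ∀ j e → j * (e + e) ≡ j * e + j * e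
      double-product = solve-∀
      regroup : ∀ s r q m → s + ((r + q * m) + (r + q * m)) ≡ (s + (r + r)) + q * (m + m)
      regroup = solve-∀
      2+2r : ∀ r → 2 + (r + r) ≡ suc r + suc r
      2+2r = solve-∀
      halve : ∀ x → (s + (x + x)) % M ≡ s + ((x % m) + (x % m))
      halve x = trans (cong (λ z → (s + (z + z)) % M) (m≡m%n+[m/n]*n x m))
        (trans (cong (_% M) (trans (regroup s (x % m) (x / m) m) (cong (λ z → (s + (x % m + x % m)) + (x / m) * z) (sym M≡2m))))
          (trans (+kM≈ (s + (x % m + x % m)) (x / m)) (m<n⇒m%n≡m bound)))
        where
        r<m = m%n<n x m
        bound : s + (x % m + x % m) < M
        bound = subst (s + (x % m + x % m) <_) (sym M≡2m)
          (≤-trans (+-monoˡ-≤ (x % m + x % m) s<2) (≤-trans (≤-reflexive (2+2r (x % m))) (+-mono-≤ r<m r<m)))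

    rotated-suc : ∀ j s → (rotated j s + c) % M ≡ rotated (suc j) s
    rotated-suc j s = trans (≈-+ˡ c (%≈ (s + j * c))) (cong (_% M) (regroup s j c))
      where
      regroup : ∀ s j c → s + j * c + c ≡ s + suc j * c
      regroup = solve-∀

    module Coprime (cop : Cop.Coprime e m) where
      -- Before m steps the orbit of s ∈ {0, 1} stays above 1, so the swap is idle.
      rotated-≥2 : ∀ j s → 0 < j → j < m → s < 2 → 2 ≤ rotated j s
      rotated-≥2 j s 0<j j<m s<2 with (j * e) % m in je%m | rotated-form j s s<2
      ... | zero | _ = ⊥-elim (<⇒≱ j<m (∣⇒≤ {{>-nonZero 0<j}}
              (Cop.coprime-divisor (Cop.sym cop) (subst (m ∣_) (*-comm j e) (m%n≡0⇒n∣m _ m je%m)))))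
      ... | suc y | form = subst (2 ≤_) (sym form) (≤-trans (s≤s (≤-trans (s≤s z≤n) (m≤n+m (suc y) y))) (m≤n+m (suc (y + suc y)) s))

      iterate-start : ∀ j s → s < 2 → j < m → iterN U j s ≡ rotated j s
      iterate-start zero s s<2 _ = sym (trans (cong (_% M) (+-identityʳ s)) (m<n⇒m%n≡m (<-≤-trans s<2 2≤M)))
        where
        2≤M : 2 ≤ M
        2≤M = subst (2 ≤_) (sym M≡2m) (+-mono-≤ (>-nonZero⁻¹ m) (>-nonZero⁻¹ m))
      iterate-start (suc j) s s<2 j+1<m =
        trans (cong U (iterate-start j s s<2 (<-trans (n<1+n j) j+1<m)))
          (trans (flip-rotates _ (m%n<n _ M)) (trans (cong swap01 (rotated-suc j s)) (swap01-id (rotated-≥2 (suc j) s z<s j+1<m s<2))))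

      half-turn : ∀ s → s < 2 → iterN U m s ≡ swap01 s
      half-turn s s<2 = trans (cong (λ z → iterN U z s) (sym m≡)) (trans (cong U (iterate-start (pred m) s s<2 (subst (pred m <_) m≡ (n<1+n _))))
        (trans (flip-rotates _ (m%n<n _ M)) (cong swap01 (trans (rotated-suc (pred m) s) (trans (cong (λ z → rotated z s) m≡) full)))))
        where
        m≡ : suc (pred m) ≡ m
        m≡ = suc-pred m
        full : rotated m s ≡ s
        full = trans (rotated-form m s s<2) (trans (cong (λ z → s + (z + z)) (trans (cong (_% m) (*-comm m e)) (m*n%n≡0 e m))) (+-identityʳ s))

      flipped-rotation-transitive : TransitiveOn M U
      flipped-rotation-transitive = transitive-from-base-point M U 0 (pred M) period reach
        where
        period : iterN U (suc (pred M)) 0 ≡ 0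
        period = trans (cong (λ z → iterN U z 0) (trans (suc-pred M) M≡2m))
                   (trans (iter-add U m m 0) (trans (cong (iterN U m) (half-turn 0 (s≤s z≤n))) (half-turn 1 (s≤s (s≤s z≤n)))))
        start : ∀ s → s < 2 → Σ ℕ λ t → iterN U t 0 ≡ s
        start zero _ = 0 , refl
        start (suc zero) _ = m , half-turn 0 (s≤s z≤n)
        start (suc (suc s)) (s≤s (s≤s ()))
        -- v = v mod 2 + 2 (v / 2): reach the parity first, then rotate.
        reach : ∀ v → v < M → Σ ℕ λ t → iterN U t 0 ≡ v
        reach v v<M with solve-congruence m e cop (v / 2) | start (v % 2) (m%n<n v 2)
        ... | j , j<m , je≈ | t₀ , reached₀ = j + t₀ , (begin
          iterN U (j + t₀) 0                          ≡⟨ iter-add U j t₀ 0 ⟩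
          iterN U j (iterN U t₀ 0)                    ≡⟨ cong (iterN U j) reached₀ ⟩
          iterN U j (v % 2)                           ≡⟨ iterate-start j (v % 2) (m%n<n v 2) j<m ⟩
          rotated j (v % 2)                           ≡⟨ rotated-form j (v % 2) (m%n<n v 2) ⟩
          v % 2 + ((j * e) % m + (j * e) % m)         ≡⟨ cong (λ z → v % 2 + (z + z)) (trans je≈ (m<n⇒m%n≡m v/2<m)) ⟩
          v % 2 + (v / 2 + v / 2)                     ≡⟨ cong (v % 2 +_) (twice (v / 2)) ⟩
          v % 2 + v / 2 * 2                           ≡⟨ sym (m≡m%n+[m/n]*n v 2) ⟩
          v                                           ∎)
          where
          open ≡-Reasoning
          twice : ∀ y → y + y ≡ y * 2
          twice = solve-∀
          v/2<m : v / 2 < m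
          v/2<m = m<n*o⇒m/o<n (subst (v <_) (trans M≡2m (twice m)) v<M)

    -- A common divisor G ≥ 2 of i and m makes the class 2 mod 2G invariant:
    -- the rotation moves by a multiple of 2G, and the swap never acts on it.
    module NotCoprime (gcd≢1 : gcd i m ≢ 1) where
      G = gcd i m
      G∣m = gcd[m,n]∣n i m
      G∣e : G ∣ e
      G∣e = ∣m+n∣m⇒∣n (subst (G ∣_) (trans (sym e+i≡m) (+-comm e i)) G∣m) (gcd[m,n]∣m i m)
      2≤G : 2 ≤ G
      2≤G = ≢0∧≢1⇒≥2 (≢-nonZero⁻¹ G {{divisor-nonZero G∣m}}) gcd≢1
      2G = G + G
      4≤2G : 4 ≤ 2G
      4≤2G = +-mono-≤ 2≤G 2≤G
      instance
        2G≢0 : NonZero 2G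
        2G≢0 = >-nonZero (<-≤-trans (s≤s z≤n) 4≤2G)
      2G∣M : 2G ∣ M
      2G∣M = subst (2G ∣_) (sym M≡2m) (double∣ G∣m)
      small : ∀ r → r < 4 → r % 2G ≡ r
      small r r<4 = m<n⇒m%n≡m (<-≤-trans r<4 4≤2G)
      3<M : 3 < M
      3<M = <-≤-trans (s≤s (s≤s (s≤s (s≤s z≤n)))) (≤-trans 4≤2G (∣⇒≤ 2G∣M))
      swap01-< : ∀ {y} → y < M → swap01 y < M
      swap01-< {zero} _ = <-trans (s≤s (s≤s z≤n)) (<-trans (s≤s (s≤s (s≤s z≤n))) 3<M)
      swap01-< {suc zero} _ = <-trans (s≤s z≤n) (<-trans (s≤s (s≤s z≤n)) (<-trans (s≤s (s≤s (s≤s z≤n))) 3<M))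
      swap01-< {suc (suc y)} y<M = y<M
      U-< : ∀ x → x < M → U x < M
      U-< x x<M = subst (_< M) (sym (flip-rotates x x<M)) (swap01-< (m%n<n (x + c) M))
      invariant : ∀ x → x < M → x % 2G ≡ 2 → U x % 2G ≡ 2
      invariant x x<M x%2G≡2 = subst (λ z → z % 2G ≡ 2) (sym (trans (flip-rotates x x<M) (swap01-id y≥2))) y%2G≡2
        where
        y = (x + c) % M
        y%2G≡2 : y % 2G ≡ 2
        y%2G≡2 = trans (m∣n⇒o%n%m≡o%m 2G M (x + c) 2G∣M)
          (trans (%-distribˡ-+ x c 2G) (trans (cong₂ (λ p q → (p + q) % 2G) x%2G≡2 (n∣m⇒m%n≡0 c 2G (double∣ G∣e)))
            (trans (cong (_% 2G) (+-identityʳ 2)) (small 2 (s≤s (s≤s (s≤s z≤n)))))))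
        y≥2 : 2 ≤ y
        y≥2 with y | y%2G≡2
        ... | zero | 0≡2 = ⊥-elim (0≢1+n (trans (sym (small 0 (s≤s z≤n))) 0≡2))
        ... | suc zero | 1≡2 = ⊥-elim (1+n≢n (sym (trans (sym (small 1 (s≤s (s≤s z≤n)))) 1≡2)))
        ... | suc (suc _) | _ = s≤s (s≤s z≤n)
      not-transitive : ¬ TransitiveOn M U
      not-transitive = invariant-residue-blocks-transitivity M U 2G 2 U-< invariant 2 3 (<-trans (s≤s (s≤s (s≤s z≤n))) 3<M) 3<M
        (small 2 (s≤s (s≤s (s≤s z≤n)))) (λ 3≡2 → 1+n≢n (trans (sym (small 3 (s≤s (s≤s (s≤s (s≤s z≤n)))))) 3≡2))

    flipped-rotation-transitive⇒gcd≡1 : TransitiveOn M U → gcd i m ≡ 1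
    flipped-rotation-transitive⇒gcd≡1 transitive with gcd i m ≟ 1
    ... | yes gcd≡1 = gcd≡1
    ... | no gcd≢1 = ⊥-elim (NotCoprime.not-transitive gcd≢1 transitive)

    flipped-rotation-transitive : gcd i m ≡ 1 → TransitiveOn M U
    flipped-rotation-transitive gcd≡1 = Coprime.flipped-rotation-transitive (coprime-complement e+i≡m (Cop.gcd≡1⇒coprime gcd≡1))

-- Shift the positions [a, n) to [0, M) and let
-- U be the first-return map of σ to them: a point of [a, n) either lands in
-- [a, n) again or in run₁ = [0, a), from where σ sends it straight back.
-- Writing V w = σ (a + w), one finds U = K ∘ T with two involutions of [0, M):
--   T w = (V w + d) mod M          a reflection modulo M  (T w + w ≡ b + d - 1),
--   K u = u (u < d),  M + d - 1 - u (u ≥ d)     reflecting [d, M), fixing [0, d).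
-- Then σ is transitive on [0, n) iff U is transitive on [0, M), and K reverses U.
module ReturnMap (a d b : ℕ) {{_ : NonZero (a + d)}} (b≤M : b ≤ a + d) where
  M : ℕ
  M = a + d
  n : ℕ
  n = a + M
  open Mod M

  a+b≤n : a + b ≤ n
  a+b≤n = +-monoʳ-≤ a b≤M

  open Runs {n} {a} {b} a+b≤n

  σ : ℕ → ℕ
  σ = layered n a b

  V : ℕ → ℕ
  V w = σ (a + w)

  shift-sum : ∀ x a w → x + suc (a + w) ≡ a + (x + suc w)
  shift-sum = solve-∀

  V-run₂ : ∀ {u} → u < b → V u + suc u ≡ b
  V-run₂ {u} u<b = +-cancelˡ-≡ a _ _ (trans (sym (shift-sum (V u) a u)) (run₂-sum (m≤m+n a u) (+-monoʳ-< a u<b)))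

  V-run₃ : ∀ {u} → b ≤ u → u < M → V u + suc u ≡ M + b
  V-run₃ {u} b≤u u<M = +-cancelˡ-≡ a _ _ (trans (sym (shift-sum (V u) a u))
                         (trans (run₃-sum (+-monoʳ-≤ a b≤u) (+-monoʳ-< a u<M)) (+-assoc a M b)))

  V-< : ∀ {w} → w < M → V w < M
  V-< {w} w<M with b ≤? w
  ... | yes b≤w = +-suc-cancelʳ-< w (subst (_≤ M + w) (sym (V-run₃ b≤w w<M)) (+-monoʳ-≤ M b≤w))
  ... | no b≰w = <-≤-trans (m<m+n (V w) z<s) (subst (_≤ M) (sym (V-run₂ (≰⇒> b≰w))) b≤M)

  V-sum : ∀ {w} → w < M → V w + suc w ≈ b
  V-sum {w} w<M with b ≤? w
  ... | yes b≤w = trans (cong (_% M) (trans (V-run₃ b≤w w<M) (+-comm M b))) (+M≈ b)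
  ... | no b≰w = cong (_% M) (V-run₂ (≰⇒> b≰w))

  T : ℕ → ℕ
  T w = (V w + d) % M

  T-< : ∀ w → T w < M
  T-< w = m%n<n _ M

  T-sum : ∀ {w} → w < M → T w + suc w ≈ b + d
  T-sum {w} w<M = ≈-trans (≈-+ˡ (suc w) (%≈ (V w + d)))
                    (≈-trans (≡⇒≈ (regroup (V w) d w)) (≈-+ˡ d (V-sum w<M)))
    where
    regroup : ∀ v d w → v + d + suc w ≡ (v + suc w) + d
    regroup = solve-∀

  T-involutive : ∀ {w} → w < M → T (T w) ≡ w
  T-involutive {w} w<M = ≈-eq (T-< _) w<M (≈-cancel (suc (T w))
    (≈-trans (T-sum (T-< w)) (≈-trans (≈-sym (T-sum w<M)) (≡⇒≈ (swap-suc (T w) w)))))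

  K : ℕ → ℕ
  K u with u <? d
  ... | yes _ = u
  ... | no _ = M + d ∸ suc u

  K-fixes : ∀ {u} → u < d → K u ≡ u
  K-fixes {u} u<d with u <? d
  ... | yes _ = refl
  ... | no u≮d = ⊥-elim (u≮d u<d)

  K-sum : ∀ {u} → d ≤ u → u < M → K u + suc u ≡ M + d
  K-sum {u} d≤u u<M with u <? d
  ... | yes u<d = ⊥-elim (<⇒≱ u<d d≤u)
  ... | no _ = m∸n+n≡m (≤-trans u<M (m≤m+n M d))

  K-< : ∀ {u} → u < M → K u < M
  K-< {u} u<M with d ≤? u
  ... | no d≰u = subst (_< M) (sym (K-fixes (≰⇒> d≰u))) u<M
  ... | yes d≤u = +-suc-cancelʳ-< u (≤-trans (≤-reflexive (K-sum d≤u u<M)) (+-monoʳ-≤ M d≤u))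

  K-≥d : ∀ {u} → d ≤ u → u < M → d ≤ K u
  K-≥d {u} d≤u u<M = +-cancelʳ-≤ (suc u) _ _ (subst (d + suc u ≤_) (sym (K-sum d≤u u<M))
                       (subst (_≤ M + d) (+-comm (suc u) d) (+-monoˡ-≤ d u<M)))

  K-involutive : ∀ {u} → u < M → K (K u) ≡ u
  K-involutive {u} u<M with d ≤? u
  ... | no d≰u = trans (cong K (K-fixes (≰⇒> d≰u))) (K-fixes (≰⇒> d≰u))
  ... | yes d≤u = +-cancelʳ-≡ (suc (K u)) _ _
        (trans (K-sum (K-≥d d≤u u<M) (K-< u<M)) (trans (sym (K-sum d≤u u<M)) (swap-suc (K u) u)))

  U : ℕ → ℕ
  U w = K (T w)

  U-< : ∀ {w} → w < M → U w < M
  U-< {w} _ = K-< (T-< w)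

  U-injective : ∀ u v → u < M → v < M → U u ≡ U v → u ≡ v
  U-injective u v u<M v<M e = trans (sym (T-involutive u<M))
    (trans (cong T (trans (sym (K-involutive (T-< u))) (trans (cong K e) (K-involutive (T-< v))))) (T-involutive v<M))

  K-reverses-U : ∀ x → x < M → U (K (U x)) ≡ K x
  K-reverses-U x x<M = cong K (trans (cong T (K-involutive (T-< x))) (T-involutive x<M))

  return-step : ∀ {w} → w < M → (V w < a × σ (V w) ≡ a + U w) ⊎ (a ≤ V w × V w ≡ a + U w)
  return-step {w} w<M with a ≤? V w
  ... | no a≰V = inj₁ (V<a , +-cancelʳ-≡ (suc (V w)) _ _
          (trans (run₁-sum V<a) (trans (cong (a +_) (sym U+V)) (sym (+-assoc a (U w) (suc (V w)))))))
    where
    V<a : V w < a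
    V<a = ≰⇒> a≰V
    T≡ : T w ≡ V w + d
    T≡ = m<n⇒m%n≡m (+-monoˡ-< d V<a)
    K-of-T : K (T w) + suc (V w + d) ≡ M + d
    K-of-T = subst (λ z → K (T w) + suc z ≡ M + d) T≡ (K-sum (subst (d ≤_) (sym T≡) (m≤n+m d (V w))) (T-< w))
    regroup : ∀ x v d → x + suc (v + d) ≡ (x + suc v) + d
    regroup = solve-∀
    U+V : U w + suc (V w) ≡ M
    U+V = +-cancelʳ-≡ d _ _ (trans (sym (regroup (U w) (V w) d)) K-of-T)
  ... | yes a≤V = inj₂ (a≤V , trans (sym a+e≡V) (cong (a +_) (sym U≡e)))
    where
    e = proj₁ (m≤n⇒∃[o]m+o≡n a≤V)
    a+e≡V : a + e ≡ V w
    a+e≡V = proj₂ (m≤n⇒∃[o]m+o≡n a≤V)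
    e<d : e < d
    e<d = +-cancelˡ-< a e d (subst (_< a + d) (sym a+e≡V) (V-< w<M))
    regroup : ∀ a e d → a + e + d ≡ e + (a + d)
    regroup = solve-∀
    T≡e : T w ≡ e
    T≡e = ≈-eq (T-< w) (<-≤-trans e<d (m≤n+m d a))
            (≈-trans (%≈ (V w + d)) (≈-trans (≡⇒≈ (trans (cong (_+ d) (sym a+e≡V)) (regroup a e d))) (+M≈ e)))
    U≡e : U w ≡ e
    U≡e = trans (cong K T≡e) (K-fixes e<d)

  iterate-U-< : ∀ t {u} → u < M → iterN U t u < M
  iterate-U-< zero u<M = u<M
  iterate-U-< (suc t) u<M = U-< (iterate-U-< t u<M)

  Tracks : ℕ → ℕ → Set
  Tracks x y = x ≡ a + y ⊎ (x < a × σ x ≡ a + y)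

  track : ∀ k u → u < M → Σ ℕ λ t → Tracks (iterN σ k (a + u)) (iterN U t u)
  track zero u u<M = 0 , inj₁ refl
  track (suc k) u u<M with track k u u<M
  ... | t , inj₂ (_ , σx≡) = t , inj₁ σx≡
  ... | t , inj₁ x≡ with return-step (iterate-U-< t u<M)
  ...   | inj₁ (V<a , σV≡) = suc t , inj₂ (subst (_< a) (sym (cong σ x≡)) V<a , trans (cong (λ z → σ (σ z)) x≡) σV≡)
  ...   | inj₂ (_ , V≡) = suc t , inj₁ (trans (cong σ x≡) V≡)

  transitive-σ⇒transitive-U : TransitiveOn n σ → TransitiveOn M U
  transitive-σ⇒transitive-U transitive u v u<M v<M with transitive (a + u) (a + v) (+-monoʳ-< a u<M) (+-monoʳ-< a v<M)
  ... | k , reached with track k u u<M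
  ...   | t , inj₁ x≡ = t , +-cancelˡ-≡ a _ _ (trans (sym x≡) reached)
  ...   | t , inj₂ (x<a , _) = ⊥-elim (<⇒≱ x<a (subst (a ≤_) (sym reached) (m≤m+n a v)))

  lift-U-steps : ∀ t u → u < M → Σ ℕ λ k → iterN σ k (a + u) ≡ a + iterN U t u
  lift-U-steps zero u u<M = 0 , refl
  lift-U-steps (suc t) u u<M with lift-U-steps t u u<M
  ... | k , x≡ with return-step (iterate-U-< t u<M)
  ...   | inj₁ (_ , σV≡) = suc (suc k) , trans (cong (λ z → σ (σ z)) x≡) σV≡
  ...   | inj₂ (_ , V≡) = suc k , trans (cong σ x≡) V≡

  enter-upper-part : ∀ i → i < n → Σ ℕ λ k → Σ ℕ λ u → u < M × iterN σ k i ≡ a + u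
  enter-upper-part i i<n with a ≤? i
  ... | yes a≤i = 0 , proj₁ split , +-cancelˡ-< a _ _ (subst (_< a + M) (sym (proj₂ split)) i<n) , sym (proj₂ split)
    where split = m≤n⇒∃[o]m+o≡n a≤i
  ... | no a≰i = 1 , u , u<M , σi≡
    where
    split = m<n⇒∃[o]m+suc[o]≡n (<-≤-trans (≰⇒> a≰i) (m≤m+n a d))
    u = proj₁ split
    u<M : u < M
    u<M = subst (u <_) (proj₂ split) (≤-trans (n<1+n u) (m≤n+m (suc u) i))
    σi≡ : σ i ≡ a + u
    σi≡ = +-cancelʳ-≡ (suc i) _ _ (trans (run₁-sum (≰⇒> a≰i))
            (trans (cong (a +_) (sym (proj₂ split))) (trans (cong (a +_) (swap-suc i u)) (sym (+-assoc a u (suc i))))))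

  exit-upper-part : ∀ j → j < n → Σ ℕ λ u → Σ ℕ λ k → u < M × iterN σ k (a + u) ≡ j
  exit-upper-part j j<n with a ≤? j
  ... | yes a≤j = proj₁ split , 0 , +-cancelˡ-< a _ _ (subst (_< a + M) (sym (proj₂ split)) j<n) , proj₂ split
    where split = m≤n⇒∃[o]m+o≡n a≤j
  ... | no a≰j with b ≤? j
  ...   | no b≰j = u , 1 , <-≤-trans u<b b≤M , V≡j
    where
    split = m<n⇒∃[o]m+suc[o]≡n (≰⇒> b≰j)
    u = proj₁ split
    u<b : u < b
    u<b = subst (u <_) (proj₂ split) (≤-trans (n<1+n u) (m≤n+m (suc u) j))
    V≡j : V u ≡ j
    V≡j = +-cancelʳ-≡ (suc u) _ _ (trans (V-run₂ u<b) (sym (proj₂ split)))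
  ...   | yes b≤j = u , 1 , u<M , V≡j
    where
    j<M : j < M
    j<M = <-≤-trans (≰⇒> a≰j) (m≤m+n a d)
    split = m<n⇒∃[o]m+suc[o]≡n (<-≤-trans j<M (m≤m+n M b))
    u = proj₁ split
    u+1+j : u + suc j ≡ M + b
    u+1+j = trans (swap-suc u j) (proj₂ split)
    b≤u : b ≤ u
    b≤u = balance-≤ {u} {b} {suc j} {M} (trans u+1+j (+-comm M b)) j<M
    u<M : u < M
    u<M = balance-< {M} {u} {b} {suc j} (sym u+1+j) (s≤s b≤j)
    V≡j : V u ≡ j
    V≡j = +-cancelʳ-≡ (suc u) _ _ (trans (V-run₃ b≤u u<M) (sym (proj₂ split)))

  transitive-U⇒transitive-σ : TransitiveOn M U → TransitiveOn n σ
  transitive-U⇒transitive-σ transitive i j i<n j<n with enter-upper-part i i<n | exit-upper-part j j<n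
  ... | k₁ , u , u<M , entered | u′ , k₂ , u′<M , exited with transitive u u′ u<M u′<M
  ...   | t , U-reached with lift-U-steps t u u<M
  ...     | k , lifted = k₂ + (k + k₁) , (begin
    iterN σ (k₂ + (k + k₁)) i                ≡⟨ iter-add σ k₂ (k + k₁) i ⟩
    iterN σ k₂ (iterN σ (k + k₁) i)          ≡⟨ cong (iterN σ k₂) (iter-add σ k k₁ i) ⟩
    iterN σ k₂ (iterN σ k (iterN σ k₁ i))    ≡⟨ cong (λ z → iterN σ k₂ (iterN σ k z)) entered ⟩
    iterN σ k₂ (iterN σ k (a + u))           ≡⟨ cong (iterN σ k₂) (trans lifted (cong (a +_) U-reached)) ⟩
    iterN σ k₂ (a + u′)                      ≡⟨ exited ⟩
    j                                        ∎)
    where open ≡-Reasoning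

  open TransitiveMap M U (λ u u<M → U-< u<M) U-injective using (module Reversed)

  K-at-most-two-fixed-points : TransitiveOn M U → ∀ u₀ u₁ u₂ → u₀ < M → u₁ < M → u₂ < M →
                               u₁ ≢ u₀ → u₂ ≢ u₀ → u₁ ≢ u₂ → K u₀ ≡ u₀ → K u₁ ≡ u₁ → K u₂ ≡ u₂ → ⊥
  K-at-most-two-fixed-points transitive = Reversed.at-most-two-fixed-points transitive K K-reverses-U

  K-fixed-point-excludes-flipped-edge : TransitiveOn M U → ∀ h u₀ w → M ≡ h + h → u₀ < M → K u₀ ≡ u₀ →
                                        w < M → K (U w) ≡ w → ⊥
  K-fixed-point-excludes-flipped-edge transitive = Reversed.fixed-point-excludes-flipped-edge transitive K K-reverses-U
-- Off the fixed
-- interval [0, d) of K the return map U is the rotation by c = M - b; so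
--   d ≤ 1 : U is that rotation, cyclic iff gcd(b, M) = 1;
--   d ≥ 3 : K has the three fixed points 0, 1, 2, impossible on a cycle;
--   d = 2 : for a odd, K fixes 0, 1 and (a + 3)/2; for a even and b odd, K
--           fixes 0 and flips the edge at (b + 1)/2 while M is even; for a and
--           b even, U is the rotation by c with 0 and 1 swapped.
module CyclicLayered (a d b : ℕ) {{_ : NonZero (a + d)}} (b≤M : b ≤ a + d) where
  open ReturnMap a d b b≤M
  open Mod M

  c : ℕ
  c = M ∸ b
  c+b≡M : c + b ≡ M
  c+b≡M = m∸n+n≡m b≤M

  rotate : ℕ → ℕ
  rotate w = (w + c) % M

  rotate-< : ∀ w → rotate w < M
  rotate-< w = m%n<n _ M

  rotate+b : ∀ w → rotate w + b ≈ w
  rotate+b w = ≈-trans (≈-+ˡ b (%≈ (w + c))) (≈-trans (≡⇒≈ (trans (+-assoc w c b) (cong (w +_) c+b≡M))) (+M≈ w))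

  reflected-step : ∀ {w} → w < M → d ≤ T w → U w + b ≈ w
  reflected-step {w} w<M d≤T = ≈-cancel (suc (T w))
    (≈-trans (≡⇒≈ (trans (regroup (U w) b (T w)) (cong (_+ b) (K-sum d≤T (T-< w)))))
      (≈-trans (≡⇒≈ (trans (+-assoc M d b) (+-comm M (d + b)))) (≈-trans (+M≈ (d + b))
        (≈-trans (≡⇒≈ (+-comm d b)) (≈-trans (≈-sym (T-sum w<M)) (≡⇒≈ (swap-suc (T w) w)))))))
    where
    regroup : ∀ x b t → (x + b) + suc t ≡ (x + suc t) + b
    regroup = solve-∀

  rotation-step : ∀ {w} → w < M → U w + b ≈ w → U w ≡ rotate w
  rotation-step {w} w<M U+b≈w = ≈-eq (U-< w<M) (rotate-< w) (≈-cancel b (≈-trans U+b≈w (≈-sym (rotate+b w))))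

  U-rotates-when-d≤1 : d ≤ 1 → ∀ w → w < M → U w ≡ rotate w
  U-rotates-when-d≤1 d≤1 w w<M with d ≤? T w
  ... | yes d≤T = rotation-step w<M (reflected-step w<M d≤T)
  ... | no d≰T = rotation-step w<M (subst (λ z → z + b ≈ w) (sym U≡0) w≈b)
    where
    T<d : T w < d
    T<d = ≰⇒> d≰T
    T≡0 : T w ≡ 0
    T≡0 = n<1⇒n≡0 (<-≤-trans T<d d≤1)
    d≡1 : d ≡ 1
    d≡1 = ≤-antisym d≤1 (<-≤-trans (s≤s z≤n) (subst (_< d) T≡0 T<d))
    U≡0 : U w ≡ 0
    U≡0 = trans (K-fixes T<d) T≡0
    w≈b : 0 + b ≈ w
    w≈b = ≈-sym (≈-cancel 1 (≈-trans (≡⇒≈ (+-comm w 1))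
            (≈-trans (≡⇒≈ (cong (_+ suc w) (sym T≡0))) (≈-trans (T-sum w<M) (≡⇒≈ (cong (b +_) d≡1))))))

  U-flip-rotates-when-d≡2 : d ≡ 2 → 1 < M → ∀ w → w < M → U w ≡ swap01 (rotate w)
  U-flip-rotates-when-d≡2 d≡2 1<M w w<M with d ≤? T w
  ... | yes d≤T = trans rotates (sym (swap01-id (subst (2 ≤_) rotates (subst (_≤ U w) d≡2 (K-≥d d≤T (T-< w))))))
    where rotates = rotation-step w<M (reflected-step w<M d≤T)
  ... | no d≰T = fixed (T w) (subst (T w <_) d≡2 (≰⇒> d≰T)) (K-fixes (≰⇒> d≰T))
                   (subst (λ z → T w + suc w ≈ b + z) d≡2 (T-sum w<M))
    where
    fixed : ∀ t → t < 2 → U w ≡ t → t + suc w ≈ b + 2 → U w ≡ swap01 (rotate w)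
    fixed zero _ U≡0 sum = trans U≡0 (sym (cong swap01 rotate≡1))
      where
      regroup : ∀ b → b + 2 ≡ (1 + b) + 1
      regroup = solve-∀
      rotate≡1 : rotate w ≡ 1
      rotate≡1 = ≈-eq (rotate-< w) 1<M (≈-cancel b (≈-trans (rotate+b w)
                   (≈-cancel 1 (≈-trans (≡⇒≈ (+-comm w 1)) (≈-trans sum (≡⇒≈ (regroup b)))))))
    fixed (suc zero) _ U≡1 sum = trans U≡1 (sym (cong swap01 rotate≡0))
      where
      rotate≡0 : rotate w ≡ 0
      rotate≡0 = ≈-eq (rotate-< w) (<-trans (s≤s z≤n) 1<M) (≈-cancel b (≈-trans (rotate+b w)
                   (≈-cancel 2 (≈-trans (≡⇒≈ (+-comm w 2)) sum))))
    fixed (suc (suc _)) (s≤s (s≤s ())) _ _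

  cyclic-when-d≤1 : d ≤ 1 → gcd b M ≡ 1 → TransitiveOn n σ
  cyclic-when-d≤1 d≤1 gcd≡1 = transitive-U⇒transitive-σ
    (Rotation.rotation-transitive M c U (U-rotates-when-d≤1 d≤1) (coprime-complement c+b≡M (Cop.gcd≡1⇒coprime gcd≡1)))

  cyclic⇒coprime-when-d≤1 : d ≤ 1 → TransitiveOn n σ → gcd b M ≡ 1
  cyclic⇒coprime-when-d≤1 d≤1 transitive = Cop.coprime⇒gcd≡1 (coprime-complement (trans (+-comm b c) c+b≡M)
    (Rotation.rotation-transitive⇒coprime M c U (U-rotates-when-d≤1 d≤1) (transitive-σ⇒transitive-U transitive)))

  not-cyclic-when-d≥3 : 3 ≤ d → ¬ TransitiveOn n σ
  not-cyclic-when-d≥3 d≥3 transitive = K-at-most-two-fixed-points (transitive-σ⇒transitive-U transitive) 0 1 2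
    (below 0 (s≤s z≤n)) (below 1 (s≤s (s≤s z≤n))) (below 2 (s≤s (s≤s (s≤s z≤n)))) (λ ()) (λ ()) (λ ())
    (K-fixes (<-≤-trans (s≤s z≤n) d≥3)) (K-fixes (<-≤-trans (s≤s (s≤s z≤n)) d≥3)) (K-fixes d≥3)
    where
    below : ∀ x → x < 3 → x < M
    below x x<3 = <-≤-trans (<-≤-trans x<3 d≥3) (m≤n+m d a)

  not-cyclic-when-d≡2-a-odd : ∀ k → d ≡ 2 → a ≡ k + k + 1 → ¬ TransitiveOn n σ
  not-cyclic-when-d≡2-a-odd k d≡2 a≡ transitive = K-at-most-two-fixed-points (transitive-σ⇒transitive-U transitive)
    0 1 (k + 2) (<-trans (s≤s z≤n) 1<M) 1<M k+2<M (λ ()) (k+2≢ 0 (λ ())) (k+2≢ 1 (λ ()) ∘ sym)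
    (K-fixes (subst (0 <_) (sym d≡2) (s≤s z≤n))) (K-fixes (subst (1 <_) (sym d≡2) (s≤s (s≤s z≤n)))) K-fixes-k+2
    where
    M≡ : M ≡ (k + k + 1) + 2
    M≡ = cong₂ _+_ a≡ d≡2
    regroup₁ : ∀ k → (k + 2) + suc k ≡ k + k + 1 + 2
    regroup₁ = solve-∀
    regroup₂ : ∀ k → (k + k + 1) + 2 + 2 ≡ (k + 2) + suc (k + 2)
    regroup₂ = solve-∀
    k+2<M : k + 2 < M
    k+2<M = subst (k + 2 <_) (trans (regroup₁ k) (sym M≡)) (m<m+n (k + 2) (s≤s z≤n))
    1<M : 1 < M
    1<M = ≤-<-trans (s≤s z≤n) (≤-<-trans (m≤n+m 2 k) k+2<M)
    k+2≢ : ∀ x → (∀ {y} → suc (suc y) ≢ x) → k + 2 ≢ x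
    k+2≢ x 2+y≢x e = 2+y≢x (trans (+-comm 2 k) e)
    K-fixes-k+2 : K (k + 2) ≡ k + 2
    K-fixes-k+2 = +-cancelʳ-≡ (suc (k + 2)) _ _ (trans (K-sum (subst (_≤ k + 2) (sym d≡2) (m≤n+m 2 k)) k+2<M)
                    (trans (cong₂ (λ A D → A + D + D) a≡ d≡2) (regroup₂ k)))

  M≡2[k+1] : ∀ k → d ≡ 2 → a ≡ k + k → M ≡ suc k + suc k
  M≡2[k+1] k d≡2 a≡ = trans (cong₂ _+_ a≡ d≡2) (regroup k)
    where
    regroup : ∀ k → k + k + 2 ≡ suc k + suc k
    regroup = solve-∀

  not-cyclic-when-d≡2-b-odd : ∀ k j → d ≡ 2 → a ≡ k + k → b ≡ j + j + 1 → ¬ TransitiveOn n σ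
  not-cyclic-when-d≡2-b-odd k j d≡2 a≡ b≡ transitive =
    K-fixed-point-excludes-flipped-edge (transitive-σ⇒transitive-U transitive) (suc k) 0 (suc j) M≡ 0<M
      (K-fixes (subst (0 <_) (sym d≡2) (s≤s z≤n))) j+1<M flipped
    where
    M≡ = M≡2[k+1] k d≡2 a≡
    0<M : 0 < M
    0<M = subst (0 <_) (sym M≡) (s≤s z≤n)
    j≤k : j ≤ k
    j≤k with j ≤? k
    ... | yes j≤k = j≤k
    ... | no j≰k = ⊥-elim (<-irrefl refl (<-≤-trans (m<m+n (j + j) (s≤s z≤n))
                    (≤-trans (subst₂ _≤_ b≡ M≡ b≤M) (+-mono-≤ (≰⇒> j≰k) (≰⇒> j≰k)))))
    j+1<M : suc j < M
    j+1<M = subst (suc j <_) (sym M≡) (<-≤-trans (s≤s (s≤s j≤k)) (s≤s (m≤n+m (suc k) k)))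
    regroup : ∀ j → (j + j + 1) + 2 ≡ suc j + suc (suc j)
    regroup = solve-∀
    T-fixes : T (suc j) ≡ suc j
    T-fixes = ≈-eq (T-< (suc j)) j+1<M
      (≈-cancel (suc (suc j)) (≈-trans (T-sum j+1<M) (≡⇒≈ (trans (cong₂ _+_ b≡ d≡2) (regroup j)))))
    flipped : K (U (suc j)) ≡ suc j
    flipped = trans (K-involutive (T-< (suc j))) T-fixes

  module EvenCase (k i : ℕ) (d≡2 : d ≡ 2) (a≡ : a ≡ k + k) (b≡ : b ≡ i + i) where
    M≡ = M≡2[k+1] k d≡2 a≡
    i≤k+1 : i ≤ suc k
    i≤k+1 = double-cancel-≤ (subst₂ _≤_ b≡ M≡ b≤M)
    1<M : 1 < M
    1<M = subst (1 <_) (sym M≡) (s≤s (≤-trans (s≤s z≤n) (m≤n+m (suc k) k)))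
    module FR = FlippedRotation (suc k) i M M≡ i≤k+1 U
    c≡ : c ≡ FR.c
    c≡ = +-cancelʳ-≡ b c FR.c (trans c+b≡M (trans (sym FR.c+2i≡M) (cong (FR.c +_) (sym b≡))))
    flip-rotates : ∀ w → w < M → U w ≡ swap01 ((w + FR.c) % M)
    flip-rotates w w<M = trans (U-flip-rotates-when-d≡2 d≡2 1<M w w<M) (cong (λ z → swap01 ((w + z) % M)) c≡)
    cyclic-when-coprime : gcd i (suc k) ≡ 1 → TransitiveOn n σ
    cyclic-when-coprime gcd≡1 = transitive-U⇒transitive-σ (FR.flipped-rotation-transitive flip-rotates gcd≡1)
    cyclic⇒coprime : TransitiveOn n σ → gcd i (suc k) ≡ 1
    cyclic⇒coprime transitive = FR.flipped-rotation-transitive⇒gcd≡1 flip-rotates (transitive-σ⇒transitive-U transitive)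


third-point : ∀ x y → Σ ℕ λ j → j < 3 × j ≢ x × j ≢ y
third-point x y with 0 ≟ x | 0 ≟ y
... | no 0≢x | no 0≢y = 0 , s≤s z≤n , 0≢x , 0≢y
... | yes refl | _ with 1 ≟ y
...   | no 1≢y = 1 , s≤s (s≤s z≤n) , (λ ()) , 1≢y
...   | yes refl = 2 , s≤s (s≤s (s≤s z≤n)) , (λ ()) , (λ ())
third-point x y | no _ | yes refl with 1 ≟ x
... | no 1≢x = 1 , s≤s (s≤s z≤n) , 1≢x , (λ ())
... | yes refl = 2 , s≤s (s≤s (s≤s z≤n)) , (λ ()) , (λ ())

-- If n < 2a, the last position a - 1 of run₁ and its value v lie in a cycle
-- {a - 1, v} of length at most two, so for n ≥ 3 the permutation is not cyclic.
module FirstRunTooLong {n a b : ℕ} (a+b≤n : a + b ≤ n) (n<2a : n < a + a) where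
  open Runs {n} {a} {b} a+b≤n
  σ = layered n a b

  0<a : 0 < a
  0<a = n≢0⇒n>0 (λ a≡0 → <⇒≱ (subst (λ z → n < z + z) a≡0 n<2a) z≤n)

  i = pred a
  i+1≡a : suc i ≡ a
  i+1≡a = suc-pred a {{>-nonZero 0<a}}
  i<a : i < a
  i<a = subst (i <_) i+1≡a (n<1+n i)
  i<n : i < n
  i<n = <-≤-trans i<a (≤-trans (m≤m+n a b) a+b≤n)

  v = σ i
  v+a≡n : v + a ≡ n
  v+a≡n = trans (cong (v +_) (sym i+1≡a)) (run₁-sum i<a)
  v<a : v < a
  v<a = +-cancelʳ-< a v a (subst (_< a + a) (sym v+a≡n) n<2a)

  σv≡i : σ v ≡ i
  σv≡i = +-cancelʳ-≡ (suc v) _ _ (trans (run₁-sum v<a) (trans (sym v+a≡n) (trans (cong (v +_) (sym i+1≡a)) (swap-suc v i))))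

  two-cycle : ∀ k → iterN σ k i ≡ i ⊎ iterN σ k i ≡ v
  two-cycle zero = inj₁ refl
  two-cycle (suc k) with two-cycle k
  ... | inj₁ at-i = inj₂ (cong σ at-i)
  ... | inj₂ at-v = inj₁ (trans (cong σ at-v) σv≡i)

  not-cyclic : 3 ≤ n → ¬ TransitiveOn n σ
  not-cyclic n≥3 transitive with third-point i v
  ... | j , j<3 , j≢i , j≢v with transitive i j i<n (<-≤-trans j<3 n≥3)
  ...   | k , reached with two-cycle k
  ...     | inj₁ at-i = j≢i (trans (sym reached) at-i)
  ...     | inj₂ at-v = j≢v (trans (sym reached) at-v)

even-or-odd : ∀ x → Σ ℕ λ k → x ≡ k + k ⊎ x ≡ k + k + 1
even-or-odd zero = 0 , inj₁ refl
even-or-odd (suc x) with even-or-odd x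
... | k , inj₁ x≡ = k , inj₂ (trans (cong suc x≡) (+-comm 1 (k + k)))
... | k , inj₂ x≡ = suc k , inj₁ (trans (cong suc x≡) (regroup k))
  where
  regroup : ∀ k → suc (k + k + 1) ≡ suc k + suc k
  regroup = solve-∀

data CyclicParameters (n a b : ℕ) : Set where
  rotation : ∀ d → d ≤ 1 → n ≡ a + (a + d) → gcd b (a + d) ≡ 1 → CyclicParameters n a b
  flipped-rotation : ∀ k i → a ≡ k + k → b ≡ i + i → n ≡ a + (a + 2) → gcd i (suc k) ≡ 1 → CyclicParameters n a b

a+d-nonZero : ∀ {n a d} → 3 ≤ n → n ≡ a + (a + d) → NonZero (a + d)
a+d-nonZero {n} {a} {d} n≥3 n≡ = ≢-nonZero a+d≢0
  where
  a+d≢0 : a + d ≢ 0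
  a+d≢0 e = <-irrefl refl (<-≤-trans (<-≤-trans (s≤s z≤n) n≥3)
              (≤-reflexive (trans n≡ (trans (cong (_+ (a + d)) (m+n≡0⇒m≡0 a e)) e))))

b≤a+d : ∀ {n a b d} → a + b ≤ n → n ≡ a + (a + d) → b ≤ a + d
b≤a+d {n} {a} {b} {d} a+b≤n n≡ = +-cancelˡ-≤ a b (a + d) (subst (a + b ≤_) n≡ a+b≤n)

transitive-along : ∀ {n n′ a b} → n ≡ n′ → TransitiveOn n (layered n a b) → TransitiveOn n′ (layered n′ a b)
transitive-along {a = a} {b} n≡n′ = subst (λ m → TransitiveOn m (layered m a b)) n≡n′

cyclic⇒parameters : ∀ {n a b} → a + b ≤ n → 3 ≤ n → TransitiveOn n (layered n a b) → CyclicParameters n a b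
cyclic⇒parameters {n} {a} {b} a+b≤n n≥3 transitive with a + a ≤? n
... | no 2a≰n = ⊥-elim (FirstRunTooLong.not-cyclic {n} {a} {b} a+b≤n (≰⇒> 2a≰n) n≥3 transitive)
... | yes 2a≤n = by-d
  where
  d = n ∸ (a + a)
  n≡ : n ≡ a + (a + d)
  n≡ = trans (sym (m+[n∸m]≡n 2a≤n)) (+-assoc a a d)
  instance
    _ : NonZero (a + d)
    _ = a+d-nonZero {n} {a} {d} n≥3 n≡
  open CyclicLayered a d b (b≤a+d a+b≤n n≡)
  transitive′ = transitive-along {a = a} {b} n≡ transitive
  by-d : CyclicParameters n a b
  by-d with d ≤? 1
  ... | yes d≤1 = rotation d d≤1 n≡ (cyclic⇒coprime-when-d≤1 d≤1 transitive′)
  ... | no d≰1 with d ≟ 2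
  ...   | no d≢2 = ⊥-elim (not-cyclic-when-d≥3 (≤∧≢⇒< (≰⇒> d≰1) (d≢2 ∘ sym)) transitive′)
  ...   | yes d≡2 with even-or-odd a
  ...     | k , inj₂ a≡ = ⊥-elim (not-cyclic-when-d≡2-a-odd k d≡2 a≡ transitive′)
  ...     | k , inj₁ a≡ with even-or-odd b
  ...       | j , inj₂ b≡ = ⊥-elim (not-cyclic-when-d≡2-b-odd k j d≡2 a≡ b≡ transitive′)
  ...       | i , inj₁ b≡ = flipped-rotation k i a≡ b≡ (trans n≡ (cong (λ z → a + (a + z)) d≡2))
                              (EvenCase.cyclic⇒coprime k i d≡2 a≡ b≡ transitive′)

parameters⇒cyclic : ∀ {n a b} → a + b ≤ n → 3 ≤ n → CyclicParameters n a b → TransitiveOn n (layered n a b)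
parameters⇒cyclic {n} {a} {b} a+b≤n n≥3 (rotation d d≤1 n≡ gcd≡1) =
  transitive-along {a = a} {b} (sym n≡) (CyclicLayered.cyclic-when-d≤1 a d b {{a+d-nonZero {n} {a} {d} n≥3 n≡}} (b≤a+d a+b≤n n≡) d≤1 gcd≡1)
parameters⇒cyclic {n} {a} {b} a+b≤n n≥3 (flipped-rotation k i a≡ b≡ n≡ gcd≡1) =
  transitive-along {a = a} {b} (sym n≡) (CyclicLayered.EvenCase.cyclic-when-coprime a 2 b {{a+d-nonZero {n} {a} {2} n≥3 n≡}}
    (b≤a+d a+b≤n n≡) k i refl a≡ b≡ gcd≡1)

module LayeredCycles {n a b : ℕ} (a+b≤n : a + b ≤ n) where
  open LayeredPerm {n} {a} {b} a+b≤n

  toℕ-iter : ∀ k (i : Fin n) → toℕ (iter (layeredPerm n a b) k i) ≡ iterN (layered n a b) k (toℕ i)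
  toℕ-iter zero i = refl
  toℕ-iter (suc k) i = trans (lookup-layeredPerm _) (cong (layered n a b) (toℕ-iter k i))

  cyclic⇒transitive : IsCyclic n (layeredPerm n a b) → TransitiveOn n (layered n a b)
  cyclic⇒transitive cyclic i j i<n j<n with cyclic (fromℕ< i<n) (fromℕ< j<n)
  ... | k , reached = k , trans (sym (cong (iterN (layered n a b) k) (FinP.toℕ-fromℕ< i<n)))
                           (trans (sym (toℕ-iter k (fromℕ< i<n))) (trans (cong toℕ reached) (FinP.toℕ-fromℕ< j<n)))

  transitive⇒cyclic : TransitiveOn n (layered n a b) → IsCyclic n (layeredPerm n a b)
  transitive⇒cyclic transitive i j with transitive (toℕ i) (toℕ j) (FinP.toℕ<n i) (FinP.toℕ<n j)
  ... | k , reached = k , FinP.toℕ-injective (trans (toℕ-iter k i) reached)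

counted⇒layered : ∀ {n} → 3 ≤ n → (p : Vec (Fin n) n) → CycAvoid n p →
                  Σ ℕ λ a → Σ ℕ λ b → a + b ≤ n × p ≡ layeredPerm n a b × CyclicParameters n a b
counted⇒layered {n} n≥3 p (p-perm , cyclic , av123 , av231) with avoider-is-layered p p-perm av123 av231
... | a , b , a+b≤n , refl = a , b , a+b≤n , refl ,
      cyclic⇒parameters a+b≤n n≥3 (LayeredCycles.cyclic⇒transitive {n} {a} {b} a+b≤n cyclic)

layered⇒counted : ∀ {n a b} → 3 ≤ n → a + b ≤ n → CyclicParameters n a b → CycAvoid n (layeredPerm n a b)
layered⇒counted {n} {a} {b} n≥3 a+b≤n params =
  layeredPerm-isPerm , LayeredCycles.transitive⇒cyclic {n} {a} {b} a+b≤n (parameters⇒cyclic a+b≤n n≥3 params) ,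
  layeredPerm-avoids-123 , layeredPerm-avoids-231
  where open LayeredPerm {n} {a} {b} a+b≤n

coprimes : ℕ → List ℕ
coprimes z = filter (λ i → gcd i z ≟ 1) (map suc (upTo z))

∈-coprimes⁻ : ∀ {z i} → i ∈ coprimes z → 1 ≤ i × i ≤ z × gcd i z ≡ 1
∈-coprimes⁻ {z} {i} i∈ with ∈-filter⁻ (λ i → gcd i z ≟ 1) {xs = map suc (upTo z)} i∈
... | i∈range , coprime with ∈-map⁻ suc i∈range
...   | x , x∈upTo , refl = s≤s z≤n , ∈-upTo⁻ x∈upTo , coprime

∈-coprimes⁺ : ∀ {z i} → 1 ≤ i → i ≤ z → gcd i z ≡ 1 → i ∈ coprimes z
∈-coprimes⁺ {z} {suc i} (s≤s _) i+1≤z coprime = ∈-filter⁺ (λ i → gcd i z ≟ 1) (∈-map⁺ suc (∈-upTo⁺ i+1≤z)) coprime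

coprimes-unique : ∀ z → Unique (coprimes z)
coprimes-unique z = UP.filter⁺ (λ i → gcd i z ≟ 1) (UP.map⁺ suc-injective (UP.upTo⁺ z))

gcd[0,M]≡1⇒M≡1 : ∀ {M} → gcd 0 M ≡ 1 → M ≡ 1
gcd[0,M]≡1⇒M≡1 {M} g = trans (sym (gcd-identityˡ M)) g

gcd[M,M]≡1⇒M≡1 : ∀ {M} → gcd M M ≡ 1 → M ≡ 1
gcd[M,M]≡1⇒M≡1 {M} g = ∣1⇒≡1 (subst (M ∣_) g (gcd-greatest ∣-refl ∣-refl))

coprime-positive : ∀ {b M} → gcd b M ≡ 1 → M ≢ 1 → 1 ≤ b
coprime-positive {zero} g M≢1 = ⊥-elim (M≢1 (gcd[0,M]≡1⇒M≡1 g))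
coprime-positive {suc b} g M≢1 = s≤s z≤n

map-unique-locally : ∀ {A B : Set} (f : A → B) {xs : List A} →
                     (∀ {x y} → x ∈ xs → y ∈ xs → f x ≡ f y → x ≡ y) → Unique xs → Unique (map f xs)
map-unique-locally f {[]} f-inj [] = []
map-unique-locally f {x ∷ xs} f-inj (x∉xs ∷ xs!) =
  distinct xs (λ y∈ → y∈) x∉xs ∷ map-unique-locally f (λ x∈ y∈ → f-inj (there x∈) (there y∈)) xs!
  where
  distinct : ∀ ys → (∀ {y} → y ∈ ys → y ∈ xs) → All (λ y → ¬ x ≡ y) ys → All (λ y → ¬ f x ≡ y) (map f ys)
  distinct [] _ [] = []
  distinct (y ∷ ys) ys⊆xs (x≢y ∷ x≢ys) =
    (λ fx≡fy → x≢y (f-inj (here refl) (there (ys⊆xs (here refl))) fx≡fy)) ∷ distinct ys (ys⊆xs ∘ there) x≢ys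

count-by-parameters : ∀ {A B : Set} {P : B → Set} (f : A → B) (ps : List A) → Unique ps →
                      (∀ {p q} → p ∈ ps → q ∈ ps → f p ≡ f q → p ≡ q) →
                      (∀ {p} → p ∈ ps → P (f p)) →
                      (∀ x → P x → Σ A λ p → p ∈ ps × f p ≡ x) →
                      HasCount P (length ps)
count-by-parameters {P = P} f ps ps! f-inj sound complete =
  map f ps , map-unique-locally f f-inj ps! , (λ x → mk⇔ (listed x) (enumerated x)) , length-map f ps
  where
  listed : ∀ x → x ∈ map f ps → P x
  listed x x∈ with ∈-map⁻ f x∈
  ... | p , p∈ , refl = sound p∈
  enumerated : ∀ x → P x → x ∈ map f ps
  enumerated x Px with complete x Px
  ... | p , p∈ , refl = ∈-map⁺ f p∈

module LayeredValues {n a b : ℕ} (a+b≤n : a + b ≤ n) where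
  open Runs {n} {a} {b} a+b≤n
  open LayeredPerm {n} {a} {b} a+b≤n

  value-at : ∀ {j} (j<n : j < n) → toℕ (lookup (layeredPerm n a b) (fromℕ< j<n)) ≡ layered n a b j
  value-at j<n = trans (lookup-layeredPerm (fromℕ< j<n)) (cong (layered n a b) (FinP.toℕ-fromℕ< j<n))

  value-at-a : 1 ≤ b → (a<n : a < n) → toℕ (lookup (layeredPerm n a b) (fromℕ< a<n)) + suc a ≡ a + b
  value-at-a b≥1 a<n = trans (cong (_+ suc a) (value-at a<n))
                          (run₂-sum ≤-refl (subst (_< a + b) (+-identityʳ a) (+-monoʳ-< a b≥1)))

  value-in-run₁ : ∀ {j} (j<n : j < n) → j < a → toℕ (lookup (layeredPerm n a b) (fromℕ< j<n)) + suc j ≡ n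
  value-in-run₁ j<n j<a = trans (cong (_+ _) (value-at j<n)) (run₁-sum j<a)

layeredPerm-injective-in-b : ∀ {n a b b′} → a + b ≤ n → a + b′ ≤ n → 1 ≤ b → 1 ≤ b′ →
                             layeredPerm n a b ≡ layeredPerm n a b′ → b ≡ b′
layeredPerm-injective-in-b {n} {a} {b} {b′} a+b≤n a+b′≤n b≥1 b′≥1 same = +-cancelˡ-≡ a b b′
  (trans (sym (LayeredValues.value-at-a a+b≤n b≥1 a<n))
    (trans (cong (λ p → toℕ (lookup p (fromℕ< a<n)) + suc a) same) (LayeredValues.value-at-a a+b′≤n b′≥1 a<n)))
  where
  a<n : a < n
  a<n = <-≤-trans (subst (_< a + b) (+-identityʳ a) (+-monoʳ-< a b≥1)) a+b≤n

twice+0 : ∀ a → a + (a + 0) ≡ a + a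
twice+0 = solve-∀

twice+1 : ∀ a → a + (a + 1) ≡ suc (a + a)
twice+1 = solve-∀

twice+2 : ∀ a → a + (a + 2) ≡ suc a + suc a
twice+2 = solve-∀

2a+d-unique : ∀ {a a′ d d′} → a + (a + d) ≡ a′ + (a′ + d′) → d ≤ 1 → d′ ≤ 1 → a ≡ a′ × d ≡ d′
2a+d-unique {a} {a′} {zero} {zero} eq _ _ = double-injective (trans (sym (twice+0 a)) (trans eq (twice+0 a′))) , refl
2a+d-unique {a} {a′} {suc zero} {suc zero} eq _ _ =
  double-injective (suc-injective (trans (sym (twice+1 a)) (trans eq (twice+1 a′)))) , refl
2a+d-unique {a} {a′} {zero} {suc zero} eq _ _ = ⊥-elim (odd≢even a′ a (sym (trans (sym (twice+0 a)) (trans eq (twice+1 a′)))))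
2a+d-unique {a} {a′} {suc zero} {zero} eq _ _ = ⊥-elim (odd≢even a a′ (trans (sym (twice+1 a)) (trans eq (twice+0 a′))))
2a+d-unique {d = suc (suc _)} _ (s≤s ()) _
2a+d-unique {d = zero} {d′ = suc (suc _)} _ _ (s≤s ())
2a+d-unique {d = suc zero} {d′ = suc (suc _)} _ _ (s≤s ())

-- The flipped rotations need n = 4k + 2, which is neither odd nor 4 times a number.
no-flipped-rotation : ∀ {a a′ d k} → a + (a + d) ≡ a′ + (a′ + 2) → d ≤ 1 → (d ≡ 0 → Σ ℕ λ h → a ≡ h + h) →
                      a′ ≡ k + k → ⊥
no-flipped-rotation {a} {a′} {zero} {k} eq _ a-even a′≡ with a-even refl
... | h , refl = odd≢even k h (sym (trans h+h≡1+a′ (cong suc a′≡)))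
  where
  h+h≡1+a′ : h + h ≡ suc a′
  h+h≡1+a′ = double-injective (trans (sym (twice+0 (h + h))) (trans eq (twice+2 a′)))
no-flipped-rotation {a} {a′} {suc zero} eq _ _ _ = odd≢even a (suc a′) (trans (sym (twice+1 a)) (trans eq (twice+2 a′)))
no-flipped-rotation {d = suc (suc _)} _ (s≤s ()) _ _

-- For n = 2a + d with d ≤ 1 (and a even when d = 0) the cyclic avoiders are the
-- layered permutations with run₁ = [0, a) and b ∈ [1, a + d] coprime to a + d.
count-rotations : ∀ a d → d ≤ 1 → (d ≡ 0 → Σ ℕ λ h → a ≡ h + h) → 3 ≤ a + (a + d) →
                  CountIs (a + (a + d)) (φ (a + d))
count-rotations a d d≤1 a-even n≥3 =
  count-by-parameters (layeredPerm n a) (coprimes M) (coprimes-unique M) injective sound complete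
  where
  n = a + (a + d)
  M = a + d
  a+b≤n : ∀ {b} → b ≤ M → a + b ≤ n
  a+b≤n b≤M = +-monoʳ-≤ a b≤M
  injective : ∀ {b b′} → b ∈ coprimes M → b′ ∈ coprimes M → layeredPerm n a b ≡ layeredPerm n a b′ → b ≡ b′
  injective b∈ b′∈ same with ∈-coprimes⁻ b∈ | ∈-coprimes⁻ b′∈
  ... | b≥1 , b≤M , _ | b′≥1 , b′≤M , _ = layeredPerm-injective-in-b (a+b≤n b≤M) (a+b≤n b′≤M) b≥1 b′≥1 same
  sound : ∀ {b} → b ∈ coprimes M → CycAvoid n (layeredPerm n a b)
  sound b∈ with ∈-coprimes⁻ b∈
  ... | _ , b≤M , coprime = layered⇒counted {n} {a} {_} n≥3 (a+b≤n b≤M) (rotation d d≤1 refl coprime)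
  M≢1 : M ≢ 1
  M≢1 M≡1 = <⇒≱ (<-≤-trans (s≤s (s≤s (s≤s z≤n))) n≥3) (+-mono-≤ (subst (a ≤_) M≡1 (m≤m+n a d)) (≤-reflexive M≡1))
  complete : ∀ p → CycAvoid n p → Σ ℕ λ b → b ∈ coprimes M × layeredPerm n a b ≡ p
  complete p counted with counted⇒layered n≥3 p counted
  ... | a′ , b , _ , refl , flipped-rotation k _ a′≡ _ n≡ _ = ⊥-elim (no-flipped-rotation {a} {a′} {d} {k} n≡ d≤1 a-even a′≡)
  ... | a′ , b , a′+b≤n , refl , rotation d′ d′≤1 n≡ coprime with 2a+d-unique {a} {a′} {d} {d′} n≡ d≤1 d′≤1
  ...   | refl , refl = b , ∈-coprimes⁺ (coprime-positive coprime M≢1) (+-cancelˡ-≤ a b M a′+b≤n) coprime , refl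

∈-++-map⁻ : ∀ {A B : Set} {xs : List A} {ys : List B} {p : A ⊎ B} → p ∈ map inj₁ xs ++ map inj₂ ys →
            (Σ A λ x → x ∈ xs × p ≡ inj₁ x) ⊎ (Σ B λ y → y ∈ ys × p ≡ inj₂ y)
∈-++-map⁻ {xs = xs} p∈ with ∈-++⁻ (map inj₁ xs) p∈
... | inj₁ p∈xs = inj₁ (∈-map⁻ inj₁ p∈xs)
... | inj₂ p∈ys = inj₂ (∈-map⁻ inj₂ p∈ys)

-- For n = 4k + 2 two families are cyclic: the rotations with d = 0 and
-- a = 2k + 1, b ∈ [1, 2k + 1] coprime to 2k + 1, and the flipped rotations with
-- a = 2k, b = 2i, i ∈ [1, k + 1] coprime to k + 1.
count-4k+2 : ∀ k → 1 ≤ k → CountIs (4 * k + 2) (φ (k + 1) + φ (2 * k + 1))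
count-4k+2 k k≥1 = subst (CountIs n) lengths (count-by-parameters layout ps ps! injective sound complete)
  where
  n = 4 * k + 2
  a₀ = 2 * k + 1
  a₂ = k + k
  n≡a₀ : n ≡ a₀ + (a₀ + 0)
  n≡a₀ = arithmetic k
    where
    arithmetic : ∀ k → 4 * k + 2 ≡ (2 * k + 1) + ((2 * k + 1) + 0)
    arithmetic = solve-∀
  n≡a₂ : n ≡ a₂ + (a₂ + 2)
  n≡a₂ = arithmetic k
    where
    arithmetic : ∀ k → 4 * k + 2 ≡ (k + k) + ((k + k) + 2)
    arithmetic = solve-∀
  k+1≡ : k + 1 ≡ suc k
  k+1≡ = +-comm k 1
  a₂+2≡ : a₂ + 2 ≡ suc k + suc k
  a₂+2≡ = arithmetic k
    where
    arithmetic : ∀ k → (k + k) + 2 ≡ suc k + suc k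
    arithmetic = solve-∀
  n≥3 : 3 ≤ n
  n≥3 = +-monoˡ-≤ 2 (≤-trans (s≤s z≤n) (*-monoʳ-≤ 4 k≥1))
  k+1≢1 : suc k ≢ 1
  k+1≢1 e = <⇒≱ k≥1 (≤-reflexive (suc-injective e))
  a₀≢1 : a₀ ≢ 1
  a₀≢1 e = <-irrefl (sym e) (≤-trans (*-monoʳ-≤ 2 k≥1) (m≤m+n (2 * k) 1))

  ps : List (ℕ ⊎ ℕ)
  ps = map inj₁ (coprimes (k + 1)) ++ map inj₂ (coprimes a₀)

  member : ∀ {p} → p ∈ ps → (Σ ℕ λ i → i ∈ coprimes (k + 1) × p ≡ inj₁ i) ⊎ (Σ ℕ λ b → b ∈ coprimes a₀ × p ≡ inj₂ b)
  member = ∈-++-map⁻ {xs = coprimes (k + 1)} {ys = coprimes a₀}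

  layout : ℕ ⊎ ℕ → Vec (Fin n) n
  layout (inj₁ i) = layeredPerm n a₂ (i + i)
  layout (inj₂ b) = layeredPerm n a₀ b

  lengths : length ps ≡ φ (k + 1) + φ (2 * k + 1)
  lengths = trans (length-++ (map inj₁ (coprimes (k + 1))))
                  (cong₂ _+_ (length-map inj₁ (coprimes (k + 1))) (length-map inj₂ (coprimes a₀)))

  ps! : Unique ps
  ps! = UP.++⁺ (UP.map⁺ inj₁-injective (coprimes-unique (k + 1))) (UP.map⁺ inj₂-injective (coprimes-unique a₀)) disjoint
    where
    disjoint : ∀ {p} → ¬ (p ∈ map inj₁ (coprimes (k + 1)) × p ∈ map inj₂ (coprimes a₀))
    disjoint (p∈₁ , p∈₂) with ∈-map⁻ inj₁ p∈₁ | ∈-map⁻ inj₂ p∈₂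
    ... | _ , _ , refl | _ , _ , ()

  a₀+b≤n : ∀ {b} → b ≤ a₀ → a₀ + b ≤ n
  a₀+b≤n {b} b≤a₀ = subst (a₀ + b ≤_) (sym n≡a₀) (+-monoʳ-≤ a₀ (subst (b ≤_) (sym (+-identityʳ a₀)) b≤a₀))

  a₂+2i≤n : ∀ {i} → i ≤ k + 1 → a₂ + (i + i) ≤ n
  a₂+2i≤n {i} i≤ = subst (a₂ + (i + i) ≤_) (sym n≡a₂) (+-monoʳ-≤ a₂ (subst (i + i ≤_) (sym a₂+2≡) (+-mono-≤ i≤′ i≤′)))
    where i≤′ = subst (i ≤_) k+1≡ i≤

  -- The families differ at position 2k: run₂ starts there in the flipped
  -- family, while it is still in run₁ for the rotations.
  families-differ : ∀ {i b} → i ∈ coprimes (k + 1) → b ∈ coprimes a₀ → layout (inj₁ i) ≢ layout (inj₂ b)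
  families-differ {i} {b} i∈ b∈ same with ∈-coprimes⁻ i∈ | ∈-coprimes⁻ b∈
  ... | i≥1 , i≤ , coprime | _ , b≤a₀ , _ = k+1≢1 (gcd[M,M]≡1⇒M≡1 (subst (λ z → gcd z (suc k) ≡ 1) i≡k+1 coprime′))
    where
    coprime′ = subst (λ z → gcd i z ≡ 1) k+1≡ coprime
    a₂<n : a₂ < n
    a₂<n = <-≤-trans (≤-reflexive (sym (twice+1′ k))) (subst (_≤ n) (+-identityʳ a₀) (a₀+b≤n z≤n))
      where
      twice+1′ : ∀ k → 2 * k + 1 ≡ suc (k + k)
      twice+1′ = solve-∀
    flipped-value = LayeredValues.value-at-a {n} {a₂} {i + i} (a₂+2i≤n i≤) (≤-trans i≥1 (m≤m+n i i)) a₂<n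
    rotation-value = LayeredValues.value-in-run₁ {n} {a₀} {b} (a₀+b≤n b≤a₀) a₂<n (subst (a₂ <_) (arithmetic k) ≤-refl)
      where
      arithmetic : ∀ k → suc (k + k) ≡ 2 * k + 1
      arithmetic = solve-∀
    equal-sums : a₂ + (i + i) ≡ a₂ + (a₂ + 2)
    equal-sums = trans (sym flipped-value) (trans (cong (λ p → toℕ (lookup p (fromℕ< a₂<n)) + suc a₂) same) (trans rotation-value n≡a₂))
    i≡k+1 : i ≡ suc k
    i≡k+1 = double-injective (trans (+-cancelˡ-≡ a₂ _ _ equal-sums) a₂+2≡)

  injective : ∀ {p q} → p ∈ ps → q ∈ ps → layout p ≡ layout q → p ≡ q
  injective p∈ q∈ same with member p∈ | member q∈
  ... | inj₁ (i , i∈ , refl) | inj₁ (i′ , i′∈ , refl) with ∈-coprimes⁻ i∈ | ∈-coprimes⁻ i′∈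
  ...   | i≥1 , i≤ , _ | i′≥1 , i′≤ , _ = cong inj₁ (double-injective
          (layeredPerm-injective-in-b {n} {a₂} (a₂+2i≤n i≤) (a₂+2i≤n i′≤) (≤-trans i≥1 (m≤m+n i i)) (≤-trans i′≥1 (m≤m+n i′ i′)) same))
  injective p∈ q∈ same | inj₂ (b , b∈ , refl) | inj₂ (b′ , b′∈ , refl) with ∈-coprimes⁻ b∈ | ∈-coprimes⁻ b′∈
  ...   | b≥1 , b≤ , _ | b′≥1 , b′≤ , _ = cong inj₂ (layeredPerm-injective-in-b {n} {a₀} (a₀+b≤n b≤) (a₀+b≤n b′≤) b≥1 b′≥1 same)
  injective p∈ q∈ same | inj₁ (i , i∈ , refl) | inj₂ (b , b∈ , refl) = ⊥-elim (families-differ i∈ b∈ same)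
  injective p∈ q∈ same | inj₂ (b , b∈ , refl) | inj₁ (i , i∈ , refl) = ⊥-elim (families-differ i∈ b∈ (sym same))

  sound : ∀ {p} → p ∈ ps → CycAvoid n (layout p)
  sound p∈ with member p∈
  ... | inj₁ (i , i∈ , refl) with ∈-coprimes⁻ i∈
  ...   | _ , i≤ , coprime = layered⇒counted {n} {a₂} n≥3 (a₂+2i≤n i≤)
          (flipped-rotation k i refl refl n≡a₂ (subst (λ z → gcd i z ≡ 1) k+1≡ coprime))
  sound p∈ | inj₂ (b , b∈ , refl) with ∈-coprimes⁻ b∈
  ...   | _ , b≤ , coprime = layered⇒counted {n} {a₀} n≥3 (a₀+b≤n b≤)
          (rotation 0 z≤n n≡a₀ (subst (λ z → gcd b z ≡ 1) (sym (+-identityʳ a₀)) coprime))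

  complete : ∀ x → CycAvoid n x → Σ (ℕ ⊎ ℕ) λ p → p ∈ ps × layout p ≡ x
  complete x counted with counted⇒layered n≥3 x counted
  ... | a , b , a+b≤n , refl , rotation d d≤1 n≡ coprime with 2a+d-unique {a₀} {a} {0} {d} (trans (sym n≡a₀) n≡) z≤n d≤1
  ...   | refl , refl = inj₂ b , ∈-++⁺ʳ (map inj₁ (coprimes (k + 1))) (∈-map⁺ inj₂ b∈) , refl
    where
    coprime′ = subst (λ z → gcd b z ≡ 1) (+-identityʳ a₀) coprime
    b∈ = ∈-coprimes⁺ (coprime-positive coprime′ a₀≢1)
           (subst (b ≤_) (+-identityʳ a₀) (+-cancelˡ-≤ a₀ b (a₀ + 0) (subst (a₀ + b ≤_) n≡a₀ a+b≤n))) coprime′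
  complete x counted | a , b , a+b≤n , refl , flipped-rotation k′ i a≡ b≡ n≡ coprime =
    inj₁ i , ∈-++⁺ˡ (∈-map⁺ inj₁ i∈) , cong₂ (layeredPerm n) (sym a≡a₂) (sym b≡)
    where
    a≡a₂ : a ≡ a₂
    a≡a₂ = suc-injective (double-injective (trans (sym (twice+2 a)) (trans (sym n≡) (trans n≡a₂ (twice+2 a₂)))))
    coprime′ : gcd i (suc k) ≡ 1
    coprime′ = subst (λ z → gcd i (suc z) ≡ 1) (double-injective (trans (sym a≡) a≡a₂)) coprime
    2i≤ : i + i ≤ suc k + suc k
    2i≤ = subst (i + i ≤_) a₂+2≡ (+-cancelˡ-≤ a₂ (i + i) (a₂ + 2) (subst₂ _≤_ (cong₂ _+_ a≡a₂ b≡) n≡a₂ a+b≤n))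
    i∈ = ∈-coprimes⁺ (coprime-positive coprime′ k+1≢1) (subst (i ≤_) (sym k+1≡) (double-cancel-≤ 2i≤))
           (subst (λ z → gcd i z ≡ 1) (sym k+1≡) coprime′)

theorem18 : ((k : ℕ) → 1 ≤ k → CountIs (4 * k) (φ (2 * k)))
    × ((k : ℕ) → 1 ≤ k → CountIs (4 * k + 2) (φ (k + 1) + φ (2 * k + 1)))
    × ((m : ℕ) → 2 ≤ m → CountIs (2 * m ∸ 1) (φ m))
theorem18 = count-4k , count-4k+2 , count-2m-1
  where
  -- n = 4k: a = 2k (even), d = 0.
  count-4k : (k : ℕ) → 1 ≤ k → CountIs (4 * k) (φ (2 * k))
  count-4k k k≥1 = subst₂ CountIs (4k≡ k) (cong φ (+-identityʳ (2 * k)))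
    (count-rotations (2 * k) 0 z≤n (λ _ → k , 2k≡ k) (subst (3 ≤_) (sym (4k≡ k)) (≤-trans (s≤s (s≤s (s≤s z≤n))) (*-monoʳ-≤ 4 k≥1))))
    where
    4k≡ : ∀ k → 2 * k + (2 * k + 0) ≡ 4 * k
    4k≡ = solve-∀
    2k≡ : ∀ k → 2 * k ≡ k + k
    2k≡ = solve-∀
  -- n = 2m - 1: a = m - 1, d = 1.
  count-2m-1 : (m : ℕ) → 2 ≤ m → CountIs (2 * m ∸ 1) (φ m)
  count-2m-1 (suc zero) (s≤s ())
  count-2m-1 (suc (suc a′)) _ = subst₂ CountIs (2m-1≡ a′) (cong φ (+-comm (suc a′) 1))
    (count-rotations (suc a′) 1 ≤-refl (λ ()) (s≤s (≤-trans (s≤s (m≤n+m 1 a′)) (m≤n+m (suc a′ + 1) a′))))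
    where
    2m-1≡ : ∀ a → suc a + (suc a + 1) ≡ 2 * suc (suc a) ∸ 1
    2m-1≡ a = cong (suc a +_) (trans (+-comm (suc a) 1) (cong suc (sym (+-identityʳ (suc a)))))
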